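{- For every $n \ge 5$, the graph obtained from the complete graph $K_n$ by removing one edge is an edge move distance graph but is not JIS.
   Context: All graphs are finite and simple. A graph $G$ is called JIS if there exist a positive integer $n$ and an assignment of an $n$-element set $S_v$ to each vertex $v$ of $G$ such that distinct vertices receive distinct sets, and for distinct vertices $v,w$, $v$ and $w$ are adjacent iff $|S_v \cap S_w| = n-1$. An edge move on a graph consists of removing one edge and adding a new edge (one not currently present) without changing the vertex set. For graphs $G,H$ of the same order and size, the edge move distance $d_m(G,H)$ is the fewest number of edge moves needed to transform $G$ into a graph isomorphic to $H$. For a set $S$ of graphs of the same order and size, the edge move distance graph $D_m(S)$ has vertex set $S$, with two elements adjacent iff their edge move distance is $1$. A graph is an edge move distance graph if it is isomorphic to $D_m(S)$ for some finite set $S$ of pairwise non-isomorphic graphs of the same order and size. -}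

module Defs where

open import Data.Nat using (ℕ; zero; suc; _≤_; _<_; _∸_; _≡ᵇ_; _<ᵇ_)
open import Data.Nat.Properties using (≡ᵇ⇒≡)
open import Data.Bool using (Bool; true; false; _∧_; _∨_; not; if_then_else_)
open import Data.Bool.Properties using (∨-comm)
open import Data.Fin using (Fin; toℕ)
open import Data.Fin.Subset using (Subset; _∩_; ∣_∣)
open import Data.Fin.Permutation using (Permutation′; _⟨$⟩ʳ_)
open import Data.List using (List; map)
open import Data.Nat.ListAction using (sum)
open import Data.List using (allFin)
open import Data.Product using (Σ; ∃; _×_; _,_)
open import Data.Sum using (_⊎_)
open import Relation.Nullary using (¬_)
open import Relation.Binary.PropositionalEquality using (_≡_; _≢_; refl; cong₂)
open import Function.Bundles using (_⇔_)

record Graph (k : ℕ) : Set where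
  field
    adj    : Fin k → Fin k → Bool
    sym    : ∀ i j → adj i j ≡ adj j i
    irrefl : ∀ i → adj i i ≡ false
open Graph public

Adj : ∀ {k} → Graph k → Fin k → Fin k → Set
Adj G i j = adj G i j ≡ true

size : ∀ {k} → Graph k → ℕ
size {k} G = sum (map (λ i → sum (map (λ j → if adj G i j ∧ (toℕ i <ᵇ toℕ j) then 1 else 0) (allFin k))) (allFin k))

Iso : ∀ {k} → Graph k → Graph k → Set
Iso {k} G H = Σ (Permutation′ k) λ σ → ∀ i j → adj G i j ≡ adj H (σ ⟨$⟩ʳ i) (σ ⟨$⟩ʳ j)

SamePair : ∀ {k} → Fin k → Fin k → Fin k → Fin k → Set
SamePair x y a b = (x ≡ a × y ≡ b) ⊎ (x ≡ b × y ≡ a)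

EdgeMove : ∀ {k} → Graph k → Graph k → Set
EdgeMove {k} G G' =
  Σ (Fin k) λ a → Σ (Fin k) λ b → Σ (Fin k) λ c → Σ (Fin k) λ d →
    Adj G a b × adj G c d ≡ false × c ≢ d ×
    (∀ x y → Adj G' x y ⇔ ((Adj G x y × ¬ SamePair x y a b) ⊎ SamePair x y c d))

-- edge move distance exactly 1 (graphs on the same vertex count, assumed same size):
-- not isomorphic, and a single edge move turns G into a graph isomorphic to H
EdgeMoveDist1 : ∀ {k} → Graph k → Graph k → Set
EdgeMoveDist1 G H = ¬ Iso G H × ∃ λ G' → EdgeMove G G' × Iso G' H

-- X is an edge move distance graph: there is a finite family S (indexed by the
-- vertices of X, pairwise non-isomorphic, same order k and same size) such that
-- X ≅ D_m(S) (the isomorphism is absorbed into the indexing of S).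
IsEdgeMoveDistanceGraph : ∀ {m} → Graph m → Set
IsEdgeMoveDistanceGraph {m} X =
  Σ ℕ λ k → Σ (Fin m → Graph k) λ S →
    (∀ i j → i ≢ j → ¬ Iso (S i) (S j)) ×
    (∀ i j → size (S i) ≡ size (S j)) ×
    (∀ i j → Adj X i j ⇔ EdgeMoveDist1 (S i) (S j))

-- JIS: n ≥ 1 and distinct n-element sets S_v (w.l.o.g. subsets of some Fin N)
-- with v ~ w iff |S_v ∩ S_w| = n - 1 for distinct v, w.
IsJIS : ∀ {m} → Graph m → Set
IsJIS {m} G =
  Σ ℕ λ n → Σ ℕ λ N → Σ (Fin m → Subset N) λ S →
    1 ≤ n ×
    (∀ v → ∣ S v ∣ ≡ n) ×
    (∀ v w → v ≢ w → S v ≢ S w) ×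
    (∀ v w → v ≢ w → (Adj G v w ⇔ (∣ S v ∩ S w ∣ ≡ n ∸ 1)))

private
  neq : ℕ → ℕ → Bool
  neq a b = not (a ≡ᵇ b)

  isRemoved : ℕ → ℕ → Bool
  isRemoved 0 1 = true
  isRemoved 1 0 = true
  isRemoved _ _ = false

  rem-sym : ∀ a b → isRemoved a b ≡ isRemoved b a
  rem-sym 0 0 = refl
  rem-sym 0 1 = refl
  rem-sym 0 (suc (suc b)) = refl
  rem-sym 1 0 = refl
  rem-sym 1 1 = refl
  rem-sym 1 (suc (suc b)) = refl
  rem-sym (suc (suc a)) 0 = refl
  rem-sym (suc (suc a)) 1 = refl
  rem-sym (suc (suc a)) (suc (suc b)) = refl

  ≡ᵇ-sym : ∀ a b → (a ≡ᵇ b) ≡ (b ≡ᵇ a)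
  ≡ᵇ-sym zero zero = refl
  ≡ᵇ-sym zero (suc b) = refl
  ≡ᵇ-sym (suc a) zero = refl
  ≡ᵇ-sym (suc a) (suc b) = ≡ᵇ-sym a b

  ≡ᵇ-refl : ∀ a → (a ≡ᵇ a) ≡ true
  ≡ᵇ-refl zero = refl
  ≡ᵇ-refl (suc a) = ≡ᵇ-refl a

  kadj : ℕ → ℕ → Bool
  kadj a b = neq a b ∧ not (isRemoved a b)

  kadj-sym : ∀ a b → kadj a b ≡ kadj b a
  kadj-sym a b rewrite ≡ᵇ-sym a b | rem-sym a b = refl

  kadj-irr : ∀ a → kadj a a ≡ false
  kadj-irr a rewrite ≡ᵇ-refl a = refl

KnMinusEdge : (n : ℕ) → Graph n
KnMinusEdge n = record
  { adj = λ i j → kadj (toℕ i) (toℕ j)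
  ; sym = λ i j → kadj-sym (toℕ i) (toℕ j)
  ; irrefl = λ i → kadj-irr (toℕ i)
  }

module Submission where

-- Not JIS: in a JIS representation adjacent vertices carry r-sets sharing r - 1
-- elements (Johnson adjacency).  A neighbour of X is X with one element swapped out
-- and one swapped in, and two adjacent neighbours of X share the out- or the
-- in-element; so Johnson graphs contain no induced K₅ minus an edge, while K_n minus
-- {0,1} does (on the vertices 2, 3, 4, 0, 1).
--
-- Edge move distance graph: with a path on N = 2n vertices, a pendant vertex w and a
-- star, take U = path + 5-star, M j = path + 4-star + edge j—w (2 ≤ j < n) and
-- V = cycle + 3-star + edge 2—w.  One edge move turns M j into M j′, into U, or into
-- a graph that a reflection of the cycle maps onto V.  Degrees separate U, V and the
-- M j and forbid a single move from U to V; lengths of limbs (paths from a leaf to a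
-- branch vertex) separate the M j; edge moves preserve the number of edges.

open import Defs renaming (sym to adj-sym; irrefl to adj-irrefl)
open import Data.Nat using (ℕ; zero; suc; pred; _+_; _∸_; _≤_; _<_; _<ᵇ_; _≡ᵇ_; z≤n; s≤s)
import Data.Nat.Properties as ℕ
open import Data.Bool using (Bool; true; false; not; _∧_; if_then_else_)
import Data.Bool.Properties as Bool
open import Data.Fin using (Fin; zero; suc; toℕ; fromℕ<; punchIn) renaming (_<_ to _<ᶠ_)
import Data.Fin.Properties as Fin
open import Data.Fin.Permutation using (Permutation′; _⟨$⟩ʳ_; _⟨$⟩ˡ_; inverseˡ; inverseʳ; flip)
import Data.Fin.Permutation as Perm
open import Data.Vec using (Vec; []; _∷_; lookup)
open import Data.Product using (Σ; ∃; _×_; _,_; proj₁; proj₂)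
open import Data.Sum using (_⊎_; inj₁; inj₂; assocʳ; assocˡ)
open import Data.Sum.Function.Propositional using (_⊎-⇔_)
open import Data.Empty using (⊥; ⊥-elim)
open import Function using (_∘_; id)
open import Function.Bundles using (_⇔_; Equivalence; mk⇔)
open import Relation.Nullary using (¬_; Dec; yes; no; does; contradiction; ¬?)
open import Relation.Nullary.Decidable using (_×-dec_; _⊎-dec_)
open import Relation.Binary.PropositionalEquality
open import Relation.Binary.Definitions using (tri<; tri≈; tri>)

-- Johnson graphs contain no induced K₅ minus an edge

module Johnson where
  open import Data.Fin.Subset using (Subset; inside; outside; _∈_; _∉_; _⊆_; _∩_; _-_; ∣_∣)
  open import Data.Fin.Subset.Properties
    using ( _∈?_; p⊆q⇒∣p∣≤∣q∣; x∈p⇒∣p-x∣<∣p∣; x∈p∧x≢y⇒x∈p-y; x∈p∩q⁺; x∈p∩q⁻; p─q⊆p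
          ; p─⊥≡p; ⊆-antisym; ∩-comm)
  open import Data.Vec using (here; there)

  private variable
    N r : ℕ
    P Q A B C D X : Subset N

  ∣p∣≡1+∣p-x∣ : ∀ {x} → x ∈ P → ∣ P ∣ ≡ suc ∣ P - x ∣
  ∣p∣≡1+∣p-x∣ {P = inside ∷ P} here = cong (suc ∘ ∣_∣) (sym (p─⊥≡p P))
  ∣p∣≡1+∣p-x∣ {P = inside ∷ P} (there x∈P) = cong suc (∣p∣≡1+∣p-x∣ x∈P)
  ∣p∣≡1+∣p-x∣ {P = outside ∷ P} (there x∈P) = ∣p∣≡1+∣p-x∣ x∈P

  x∉p-x : ∀ (P : Subset N) x → x ∉ P - x
  x∉p-x (_ ∷ P) (suc x) (there x∈P-x) = x∉p-x P x x∈P-x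

  ∈-minus₂ : ∀ {y a b} → y ∈ P → y ≢ a → y ≢ b → y ∈ P - a - b
  ∈-minus₂ y∈P y≢a y≢b = x∈p∧x≢y⇒x∈p-y (x∈p∧x≢y⇒x∈p-y y∈P y≢a) y≢b

  ∣⊆-y∣<∣P∣ : ∀ {y} → y ∈ P → Q ⊆ P - y → ∣ Q ∣ < ∣ P ∣
  ∣⊆-y∣<∣P∣ y∈P Q⊆ = ℕ.≤-<-trans (p⊆q⇒∣p∣≤∣q∣ Q⊆) (x∈p⇒∣p-x∣<∣p∣ y∈P)

  ∣⊆-a-b∣+2≤∣P∣ : ∀ {a b} → a ∈ P → b ∈ P → a ≢ b → Q ⊆ P - a - b → 2 + ∣ Q ∣ ≤ ∣ P ∣
  ∣⊆-a-b∣+2≤∣P∣ a∈P b∈P a≢b Q⊆ =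
    ℕ.≤-trans (s≤s (∣⊆-y∣<∣P∣ (x∈p∧x≢y⇒x∈p-y b∈P (a≢b ∘ sym)) Q⊆)) (x∈p⇒∣p-x∣<∣p∣ a∈P)

  JAdj : ℕ → Subset N → Subset N → Set
  JAdj r A B = ∣ A ∩ B ∣ ≡ r ∸ 1

  no-two-misses : ∀ {a b} → ∣ P ∣ ≡ r → ∣ Q ∣ ≡ r ∸ 1 →
    a ∈ P → b ∈ P → a ≢ b → ¬ (Q ⊆ P - a - b)
  no-two-misses {r = r} ∣P∣≡r ∣Q∣≡r-1 a∈P b∈P a≢b Q⊆ =
    no-room r (subst₂ (λ q p → 2 + q ≤ p) ∣Q∣≡r-1 ∣P∣≡r (∣⊆-a-b∣+2≤∣P∣ a∈P b∈P a≢b Q⊆))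
    where
    no-room : ∀ r → ¬ (2 + (r ∸ 1) ≤ r)
    no-room zero ()
    no-room (suc r) = ℕ.1+n≰n

  unique-difference : 1 ≤ r → ∣ P ∣ ≡ r → JAdj r P Q →
    Σ (Fin N) λ a → a ∈ P × a ∉ Q × (∀ {y} → y ∈ P → y ∉ Q → y ≡ a)
  unique-difference {r = r} {P = P} {Q = Q} 1≤r ∣P∣≡r PQ
    with Fin.any? (λ a → a ∈? P ×-dec ¬? (a ∈? Q))
  ... | yes (a , a∈P , a∉Q) = a , a∈P , a∉Q , unique
    where
    unique : ∀ {y} → y ∈ P → y ∉ Q → y ≡ a
    unique {y} y∈P y∉Q with y Fin.≟ a
    ... | yes y≡a = y≡a
    ... | no y≢a = ⊥-elim (no-two-misses ∣P∣≡r PQ a∈P y∈P (y≢a ∘ sym) P∩Q⊆)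
      where
      P∩Q⊆ : P ∩ Q ⊆ P - a - y
      P∩Q⊆ z∈P∩Q with x∈p∩q⁻ P Q z∈P∩Q
      ... | z∈P , z∈Q = ∈-minus₂ z∈P (λ { refl → a∉Q z∈Q }) (λ { refl → y∉Q z∈Q })
  ... | no none = ⊥-elim (too-big 1≤r (subst₂ _≤_ ∣P∣≡r PQ (p⊆q⇒∣p∣≤∣q∣ P⊆P∩Q)))
    where
    P⊆P∩Q : P ⊆ P ∩ Q
    P⊆P∩Q {y} y∈P with y ∈? Q
    ... | yes y∈Q = x∈p∩q⁺ (y∈P , y∈Q)
    ... | no y∉Q = ⊥-elim (none (y , y∈P , y∉Q))
    too-big : ∀ {r} → 1 ≤ r → ¬ (r ≤ r ∸ 1)
    too-big {suc r} _ = ℕ.1+n≰n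

  record Swap (A B : Subset N) : Set where
    field
      out inn : Fin N
      out∈old : out ∈ A
      out∉new : out ∉ B
      inn∈new : inn ∈ B
      inn∉old : inn ∉ A
      keep : ∀ {y} → y ∈ A → y ≢ out → y ∈ B
      back : ∀ {y} → y ∈ B → y ≢ inn → y ∈ A

  swap : 1 ≤ r → ∣ A ∣ ≡ r → ∣ B ∣ ≡ r → JAdj r A B → Swap A B
  swap {A = A} {B = B} 1≤r ∣A∣≡r ∣B∣≡r AB
    with unique-difference 1≤r ∣A∣≡r AB
       | unique-difference 1≤r ∣B∣≡r (trans (cong ∣_∣ (∩-comm B A)) AB)
  ... | a , a∈A , a∉B , only-a | b , b∈B , b∉A , only-b = record
    { out = a ; inn = b ; out∈old = a∈A ; out∉new = a∉B ; inn∈new = b∈B ; inn∉old = b∉A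
    ; keep = λ {y} y∈A y≢a → decide y∈A y≢a (y ∈? B) only-a
    ; back = λ {y} y∈B y≢b → decide y∈B y≢b (y ∈? A) only-b }
    where
    decide : ∀ {E F : Subset _} {y z} → y ∈ E → y ≢ z → Dec (y ∈ F) →
             (∀ {y} → y ∈ E → y ∉ F → y ≡ z) → y ∈ F
    decide _ _ (yes y∈F) _ = y∈F
    decide y∈E y≢z (no y∉F) only = ⊥-elim (y≢z (only y∈E y∉F))

  module _ {X A B : Subset N} (sA : Swap X A) (sB : Swap X B) where
    private
      module A = Swap sA
      module B = Swap sB

    swap-unique : A.out ≡ B.out → A.inn ≡ B.inn → A ≡ B
    swap-unique eo ei = ⊆-antisym (A⊆B sA sB eo ei) (A⊆B sB sA (sym eo) (sym ei))
      where
      A⊆B : ∀ {A B} (sA : Swap X A) (sB : Swap X B) →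
            Swap.out sA ≡ Swap.out sB → Swap.inn sA ≡ Swap.inn sB → A ⊆ B
      A⊆B sA sB eo ei {y} y∈A with y Fin.≟ Swap.inn sA
      ... | yes refl = subst (_∈ _) (sym ei) (Swap.inn∈new sB)
      ... | no y≢i = Swap.keep sB (Swap.back sA y∈A y≢i)
                       (λ { refl → Swap.out∉new sA (subst (_∈ _) (sym eo) y∈A) })

    inn∉other : A.inn ≢ B.inn → A.inn ∉ B
    inn∉other ne i∈B = A.inn∉old (B.back i∈B ne)

    swaps-share : ∣ X ∣ ≡ r → JAdj r A B → A.out ≡ B.out ⊎ A.inn ≡ B.inn
    swaps-share ∣X∣≡r AB with A.out Fin.≟ B.out | A.inn Fin.≟ B.inn
    ... | yes same-out | _ = inj₁ same-out
    ... | no _ | yes same-inn = inj₂ same-inn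
    ... | no outs≢ | no inns≢ = ⊥-elim (no-two-misses ∣X∣≡r AB A.out∈old B.out∈old outs≢ A∩B⊆)
      where
      A∩B⊆ : A ∩ B ⊆ X - A.out - B.out
      A∩B⊆ y∈A∩B with x∈p∩q⁻ A B y∈A∩B
      ... | y∈A , y∈B = ∈-minus₂ (A.back y∈A (λ { refl → inn∉other inns≢ y∈B }))
                                 (λ { refl → A.out∉new y∈A }) (λ { refl → B.out∉new y∈B })

  ∈-minus⁻ : ∀ {y a} → y ∈ P - a → y ∈ P × y ≢ a
  ∈-minus⁻ {P = P} {a = a} y∈P-a = p─q⊆p P _ y∈P-a , λ { refl → x∉p-x P a y∈P-a }

  squeeze : ∀ {m r} → r ∸ 1 ≤ m → m < r → m ≡ r ∸ 1
  squeeze {r = suc r} r-1≤m m<r = ℕ.≤-antisym (ℕ.≤-pred m<r) r-1≤m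

  module _ {X C D : Subset N} (∣X∣≡r : ∣ X ∣ ≡ r) (∣C∣≡r : ∣ C ∣ ≡ r)
           (sC : Swap X C) (sD : Swap X D) (C≢D : C ≢ D) where
    private
      module C = Swap sC
      module D = Swap sD
    open ℕ.≤-Reasoning

    -- Distinct swaps of X with the same out-element are Johnson-adjacent (C ∩ D = X - out).
    same-out-adjacent : C.out ≡ D.out → JAdj r C D
    same-out-adjacent same-out = squeeze lower (subst (_ <_) ∣C∣≡r (∣⊆-y∣<∣P∣ C.inn∈new C∩D⊆))
      where
      inns≢ : C.inn ≢ D.inn
      inns≢ = C≢D ∘ swap-unique sC sD same-out
      X-out⊆ : X - C.out ⊆ C ∩ D
      X-out⊆ y∈X-o with ∈-minus⁻ y∈X-o
      ... | y∈X , y≢o = x∈p∩q⁺ (C.keep y∈X y≢o , D.keep y∈X (λ { refl → y≢o (sym same-out) }))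
      lower : r ∸ 1 ≤ ∣ C ∩ D ∣
      lower = begin
        r ∸ 1             ≡⟨ cong (_∸ 1) (trans (sym ∣X∣≡r) (∣p∣≡1+∣p-x∣ C.out∈old)) ⟩
        ∣ X - C.out ∣     ≤⟨ p⊆q⇒∣p∣≤∣q∣ X-out⊆ ⟩
        ∣ C ∩ D ∣         ∎
      C∩D⊆ : C ∩ D ⊆ C - C.inn
      C∩D⊆ y∈C∩D with x∈p∩q⁻ C D y∈C∩D
      ... | y∈C , y∈D = x∈p∧x≢y⇒x∈p-y y∈C (λ { refl → inn∉other sC sD inns≢ y∈D })

    -- Distinct swaps of X with the same in-element are Johnson-adjacent
    -- (C ∩ D = X - C.out - D.out plus the common in-element).
    same-inn-adjacent : C.inn ≡ D.inn → JAdj r C D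
    same-inn-adjacent same-inn = squeeze lower (subst (_ <_) ∣C∣≡r (∣⊆-y∣<∣P∣ D-out∈C C∩D⊆))
      where
      outs≢ : C.out ≢ D.out
      outs≢ e = C≢D (swap-unique sC sD e same-inn)
      D-out∈X-C-out : D.out ∈ X - C.out
      D-out∈X-C-out = x∈p∧x≢y⇒x∈p-y D.out∈old (outs≢ ∘ sym)
      D-out∈C : D.out ∈ C
      D-out∈C = C.keep D.out∈old (outs≢ ∘ sym)
      inn∈C∩D : C.inn ∈ C ∩ D
      inn∈C∩D = x∈p∩q⁺ (C.inn∈new , subst (_∈ D) (sym same-inn) D.inn∈new)
      X-outs⊆ : X - C.out - D.out ⊆ C ∩ D - C.inn
      X-outs⊆ y∈ with ∈-minus⁻ y∈
      ... | y∈X-Co , y≢Do with ∈-minus⁻ y∈X-Co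
      ...   | y∈X , y≢Co = x∈p∧x≢y⇒x∈p-y (x∈p∩q⁺ (C.keep y∈X y≢Co , D.keep y∈X y≢Do))
                                          (λ { refl → C.inn∉old y∈X })
      lower : r ∸ 1 ≤ ∣ C ∩ D ∣
      lower = begin
        r ∸ 1                    ≡⟨ cong (_∸ 1) (trans (sym ∣X∣≡r) (trans (∣p∣≡1+∣p-x∣ C.out∈old)
                                                   (cong suc (∣p∣≡1+∣p-x∣ D-out∈X-C-out)))) ⟩
        suc ∣ X - C.out - D.out ∣ ≤⟨ s≤s (p⊆q⇒∣p∣≤∣q∣ X-outs⊆) ⟩
        suc ∣ C ∩ D - C.inn ∣    ≡⟨ sym (∣p∣≡1+∣p-x∣ inn∈C∩D) ⟩
        ∣ C ∩ D ∣                ∎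
      C∩D⊆ : C ∩ D ⊆ C - D.out
      C∩D⊆ y∈C∩D with x∈p∩q⁻ C D y∈C∩D
      ... | y∈C , y∈D = x∈p∧x≢y⇒x∈p-y y∈C (λ { refl → D.out∉new y∈D })

  no-induced-K5-minus-edge : ∣ X ∣ ≡ r → ∣ C ∣ ≡ r →
    (sA : Swap X A) (sB : Swap X B) (sC : Swap X C) (sD : Swap X D) →
    JAdj r A B → JAdj r A C → JAdj r B C → JAdj r A D → JAdj r B D →
    A ≢ B → C ≢ D → JAdj r C D
  no-induced-K5-minus-edge {X = X} {r = r} {A = A} {B = B}
    ∣X∣≡r ∣C∣≡r sA sB sC sD AB AC BC AD BD A≢B C≢D with swaps-share sA sB ∣X∣≡r AB
  ... | inj₁ same-out = same-out-adjacent ∣X∣≡r ∣C∣≡r sC sD C≢D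
                          (trans (pinned-out sC AC BC) (sym (pinned-out sD AD BD)))
    where
    pinned-out : ∀ {E} (sE : Swap X E) → JAdj r A E → JAdj r B E → Swap.out sE ≡ Swap.out sA
    pinned-out sE AE BE with swaps-share sA sE ∣X∣≡r AE | swaps-share sB sE ∣X∣≡r BE
    ... | inj₁ e | _ = sym e
    ... | inj₂ _ | inj₁ e = trans (sym e) (sym same-out)
    ... | inj₂ eA | inj₂ eB = ⊥-elim (A≢B (swap-unique sA sB same-out (trans eA (sym eB))))
  ... | inj₂ same-inn = same-inn-adjacent ∣X∣≡r ∣C∣≡r sC sD C≢D
                          (trans (pinned-inn sC AC BC) (sym (pinned-inn sD AD BD)))
    where
    pinned-inn : ∀ {E} (sE : Swap X E) → JAdj r A E → JAdj r B E → Swap.inn sE ≡ Swap.inn sA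
    pinned-inn sE AE BE with swaps-share sA sE ∣X∣≡r AE | swaps-share sB sE ∣X∣≡r BE
    ... | inj₂ e | _ = sym e
    ... | inj₁ _ | inj₂ e = trans (sym e) (sym same-inn)
    ... | inj₁ eA | inj₁ eB = ⊥-elim (A≢B (swap-unique sA sB (trans eA (sym eB)) same-inn))

  -- K_n minus an edge (n ≥ 5) is not JIS: vertices 2, 3, 4, 0, 1 would give an
  -- induced K₅ minus the edge {0,1} in a Johnson graph.
  not-JIS : ∀ n → 5 ≤ n → ¬ IsJIS (KnMinusEdge n)
  not-JIS n@(suc (suc (suc (suc (suc _))))) (s≤s (s≤s (s≤s (s≤s (s≤s _)))))
          (r , N , S , 1≤r , card , distinct , adjacent) =
    0≁1 (no-induced-K5-minus-edge (card v2) (card v0)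
          (swap-of v3 (λ ()) refl) (swap-of v4 (λ ()) refl)
          (swap-of v0 (λ ()) refl) (swap-of v1 (λ ()) refl)
          (edge v3 v4 (λ ()) refl) (edge v3 v0 (λ ()) refl) (edge v4 v0 (λ ()) refl)
          (edge v3 v1 (λ ()) refl) (edge v4 v1 (λ ()) refl)
          (distinct v3 v4 (λ ())) (distinct v0 v1 (λ ())))
    where
    v0 v1 v2 v3 v4 : Fin n
    v0 = zero
    v1 = suc zero
    v2 = suc (suc zero)
    v3 = suc (suc (suc zero))
    v4 = suc (suc (suc (suc zero)))
    edge : ∀ v w → v ≢ w → Adj (KnMinusEdge n) v w → JAdj r (S v) (S w)
    edge v w v≢w = Equivalence.to (adjacent v w v≢w)
    swap-of : ∀ v → v2 ≢ v → Adj (KnMinusEdge n) v2 v → Swap (S v2) (S v)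
    swap-of v v≢2 2v = swap 1≤r (card v2) (card v) (edge v2 v v≢2 2v)
    0≁1 : ¬ JAdj r (S v0) (S v1)
    0≁1 e with Equivalence.from (adjacent v0 v1 (λ ())) e
    ... | ()

open Johnson using (not-JIS)

-- Isomorphisms, edge moves, degrees, edge counts and limbs

module GraphFacts where
  open import Data.List using (map; allFin; tabulate)
  open import Data.List.Properties using (map-tabulate)
  open import Data.Nat.ListAction using () renaming (sum to sumᴸ)
  open import Algebra.Properties.CommutativeMonoid.Sum ℕ.+-0-commutativeMonoid
    using (sum; ∑-distrib-+; sum-cong-≗)
  open import Data.Vec.Relation.Unary.Any using (here; there)
  import Data.Vec.Relation.Unary.Any as Any
  open import Data.Vec.Membership.Propositional using (_∈_)

  private variable
    k r : ℕ
    P Q : Set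
    G H G′ : Graph k
    a b c d x y : Fin k

  does-true : (P? : Dec P) → P → does P? ≡ true
  does-true (yes _) _ = refl
  does-true (no ¬p) p = contradiction p ¬p

  does-sound : (P? : Dec P) → does P? ≡ true → P
  does-sound (yes p) _ = p

  does-false : (P? : Dec P) → ¬ P → does P? ≡ false
  does-false (yes p) ¬p = contradiction p ¬p
  does-false (no _) _ = refl

  true-ext : ∀ {u v : Bool} → (u ≡ true → v ≡ true) → (v ≡ true → u ≡ true) → u ≡ v
  true-ext {true} {true} _ _ = refl
  true-ext {false} {false} _ _ = refl
  true-ext {true} {false} f _ = sym (f refl)
  true-ext {false} {true} _ g = g refl

  does-⇔ : (P? : Dec P) (Q? : Dec Q) → P ⇔ Q → does P? ≡ does Q?
  does-⇔ P? Q? P⇔Q = true-ext (does-true Q? ∘ Equivalence.to P⇔Q ∘ does-sound P?)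
                              (does-true P? ∘ Equivalence.from P⇔Q ∘ does-sound Q?)

  not-true : ∀ {u : Bool} → ¬ (u ≡ true) → u ≡ false
  not-true {true} ¬t = contradiction refl ¬t
  not-true {false} _ = refl

  ∈⇒lookup : ∀ {A : Set} {m} {z : A} {L : Vec A m} (z∈L : z ∈ L) → z ≡ lookup L (Any.index z∈L)
  ∈⇒lookup (here refl) = refl
  ∈⇒lookup (there z∈L) = ∈⇒lookup z∈L

  Adj? : (G : Graph k) (x y : Fin k) → Dec (Adj G x y)
  Adj? G x y = adj G x y Bool.≟ true

  Adj-sym : (G : Graph k) → Adj G x y → Adj G y x
  Adj-sym {x = x} {y = y} G xy = trans (adj-sym G y x) xy

  Adj⇒≢ : (G : Graph k) → Adj G x y → x ≢ y
  Adj⇒≢ G xy refl with trans (sym xy) (adj-irrefl G _)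
  ... | ()

  SamePair? : (x y a b : Fin k) → Dec (SamePair x y a b)
  SamePair? x y a b = ((x Fin.≟ a) ×-dec (y Fin.≟ b)) ⊎-dec ((x Fin.≟ b) ×-dec (y Fin.≟ a))

  SamePair-swap : SamePair x y a b → SamePair y x a b
  SamePair-swap (inj₁ (p , q)) = inj₂ (q , p)
  SamePair-swap (inj₂ (p , q)) = inj₁ (q , p)

  SamePair-refl : SamePair a b a b
  SamePair-refl = inj₁ (refl , refl)

  SamePair-adj : (G : Graph k) → SamePair x y a b → adj G x y ≡ adj G a b
  SamePair-adj G (inj₁ (refl , refl)) = refl
  SamePair-adj G (inj₂ (refl , refl)) = adj-sym G _ _

  edge≢non-edge : (G : Graph k) → Adj G x y → adj G a b ≡ false → ¬ SamePair x y a b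
  edge≢non-edge G xy ab sp = contradiction (trans (sym (trans (sym (SamePair-adj G sp)) xy)) ab) λ ()

  SamePair-trans : SamePair x y a b → SamePair x y c d → SamePair a b c d
  SamePair-trans (inj₁ (refl , refl)) xy≡cd = xy≡cd
  SamePair-trans (inj₂ (refl , refl)) (inj₁ (p , q)) = inj₂ (q , p)
  SamePair-trans (inj₂ (refl , refl)) (inj₂ (p , q)) = inj₁ (q , p)

  SamePair-partner : ∀ {y′} → SamePair x y a b → SamePair x y′ a b → y ≡ y′
  SamePair-partner (inj₁ (refl , refl)) (inj₁ (_ , refl)) = refl
  SamePair-partner (inj₁ (refl , refl)) (inj₂ (refl , refl)) = refl
  SamePair-partner (inj₂ (refl , refl)) (inj₁ (refl , refl)) = refl
  SamePair-partner (inj₂ (refl , refl)) (inj₂ (_ , refl)) = refl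

  Iso-refl : (G : Graph k) → Iso G G
  Iso-refl G = Perm.id , λ _ _ → refl

  Iso-sym : Iso G H → Iso H G
  Iso-sym {H = H} (σ , σ-adj) = flip σ , λ i j →
    sym (trans (σ-adj (σ ⟨$⟩ˡ i) (σ ⟨$⟩ˡ j)) (cong₂ (adj H) (inverseʳ σ) (inverseʳ σ)))

  perm-injective : (σ : Permutation′ k) → σ ⟨$⟩ʳ x ≡ σ ⟨$⟩ʳ y → x ≡ y
  perm-injective {x = x} {y} σ eq = trans (sym (inverseˡ σ)) (trans (cong (σ ⟨$⟩ˡ_) eq) (inverseˡ σ))

  Iso-adj : ((σ , _) : Iso G H) → Adj G x y → Adj H (σ ⟨$⟩ʳ x) (σ ⟨$⟩ʳ y)
  Iso-adj {x = x} {y} (σ , σ-adj) xy = trans (sym (σ-adj x y)) xy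

  Moved : (G : Graph k) (a b c d : Fin k) → Fin k → Fin k → Set
  Moved G a b c d x y = (Adj G x y × ¬ SamePair x y a b) ⊎ SamePair x y c d

  Moved? : (G : Graph k) (a b c d x y : Fin k) → Dec (Moved G a b c d x y)
  Moved? G a b c d x y = (Adj? G x y ×-dec ¬? (SamePair? x y a b)) ⊎-dec SamePair? x y c d

  moved : (G : Graph k) (a b c d : Fin k) → c ≢ d → Graph k
  moved G a b c d c≢d = record
    { adj    = λ x y → does (Moved? G a b c d x y)
    ; sym    = λ x y → does-⇔ (Moved? G a b c d x y) (Moved? G a b c d y x) (mk⇔ swap swap)
    ; irrefl = λ x → not-true (irr ∘ does-sound (Moved? G a b c d x x))
    }
    where
    swap : ∀ {x y} → Moved G a b c d x y → Moved G a b c d y x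
    swap (inj₁ (xy , ¬ab)) = inj₁ (Adj-sym G xy , ¬ab ∘ SamePair-swap)
    swap (inj₂ cd) = inj₂ (SamePair-swap cd)
    irr : ∀ {x} → ¬ Moved G a b c d x x
    irr (inj₁ (xx , _)) = Adj⇒≢ G xx refl
    irr (inj₂ (inj₁ (refl , refl))) = c≢d refl
    irr (inj₂ (inj₂ (refl , refl))) = c≢d refl

  moved-is-move : Adj G a b → adj G c d ≡ false → (c≢d : c ≢ d) →
                  EdgeMove G (moved G a b c d c≢d)
  moved-is-move {G = G} {a} {b} {c} {d} ab cd c≢d =
    a , b , c , d , ab , cd , c≢d , λ x y →
      mk⇔ (does-sound (Moved? G a b c d x y)) (does-true (Moved? G a b c d x y))

  SamePair-perm : (σ : Permutation′ k) →
    SamePair (σ ⟨$⟩ʳ x) (σ ⟨$⟩ʳ y) (σ ⟨$⟩ʳ a) (σ ⟨$⟩ʳ b) ⇔ SamePair x y a b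
  SamePair-perm σ = mk⇔
    (λ { (inj₁ (p , q)) → inj₁ (perm-injective σ p , perm-injective σ q)
       ; (inj₂ (p , q)) → inj₂ (perm-injective σ p , perm-injective σ q) })
    (λ { (inj₁ (refl , refl)) → inj₁ (refl , refl) ; (inj₂ (refl , refl)) → inj₂ (refl , refl) })

  -- Edge-move distance one is symmetric: if G ↦ G′ ≅ H by moving {a,b} to {c,d},
  -- then moving {σc,σd} back to {σa,σb} in H gives a graph isomorphic to G.
  EdgeMoveDist1-sym : EdgeMoveDist1 G H → EdgeMoveDist1 H G
  EdgeMoveDist1-sym {G = G} {H = H}
    (G≇H , G′ , (a , b , c , d , ab , cd , c≢d , G′-adj) , (σ , σ-adj)) =
    G≇H ∘ Iso-sym {G = H} {H = G} , H′ , moved-is-move {G = H} σcσd σaσb σa≢σb , flip σ , H′≅G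
    where
    s : Fin _ → Fin _
    s x = σ ⟨$⟩ʳ x
    σa≢σb : s a ≢ s b
    σa≢σb = Adj⇒≢ G ab ∘ perm-injective σ
    H′ : Graph _
    H′ = moved H (s c) (s d) (s a) (s b) σa≢σb
    G′-cd : Adj G′ c d
    G′-cd = Equivalence.from (G′-adj c d) (inj₂ SamePair-refl)
    G′-¬ab : ¬ Adj G′ a b
    G′-¬ab ab′ with Equivalence.to (G′-adj a b) ab′
    ... | inj₁ (_ , ¬ab) = ¬ab SamePair-refl
    ... | inj₂ ab≡cd = edge≢non-edge G ab cd ab≡cd
    σcσd : Adj H (s c) (s d)
    σcσd = trans (sym (σ-adj c d)) G′-cd
    σaσb : adj H (s a) (s b) ≡ false
    σaσb = trans (sym (σ-adj a b)) (not-true G′-¬ab)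
    -- H′ is G transported along σ
    back : ∀ x y → Moved H (s c) (s d) (s a) (s b) (s x) (s y) ⇔ Adj G x y
    back x y = mk⇔ to from
      where
      to : Moved H (s c) (s d) (s a) (s b) (s x) (s y) → Adj G x y
      to (inj₂ sp) = trans (SamePair-adj G (Equivalence.to (SamePair-perm σ) sp)) ab
      to (inj₁ (h , ¬cd)) with Equivalence.to (G′-adj x y) (trans (σ-adj x y) h)
      ... | inj₁ (g , _) = g
      ... | inj₂ xy≡cd = contradiction (Equivalence.from (SamePair-perm σ) xy≡cd) ¬cd
      from : Adj G x y → Moved H (s c) (s d) (s a) (s b) (s x) (s y)
      from g with SamePair? x y a b
      ... | yes xy≡ab = inj₂ (Equivalence.from (SamePair-perm σ) xy≡ab)
      ... | no xy≢ab = inj₁ (trans (sym (σ-adj x y)) (Equivalence.from (G′-adj x y) (inj₁ (g , xy≢ab))) ,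
                             edge≢non-edge G g cd ∘ Equivalence.to (SamePair-perm σ))
    H′≅G : ∀ i j → adj H′ i j ≡ adj G (flip σ ⟨$⟩ʳ i) (flip σ ⟨$⟩ʳ j)
    H′≅G i j = trans (cong₂ (adj H′) (sym (inverseʳ σ)) (sym (inverseʳ σ)))
                     (true-ext (Equivalence.to (back i′ j′) ∘ does-sound (Moved? H _ _ _ _ (s i′) (s j′)))
                               (does-true (Moved? H _ _ _ _ (s i′) (s j′)) ∘ Equivalence.from (back i′ j′)))
      where
      i′ = σ ⟨$⟩ˡ i
      j′ = σ ⟨$⟩ˡ j

  -- x has at least r distinct neighbours.  This is what isomorphism invariance
  -- and the pigeonhole principle give us about degrees.
  DegreeAtLeast : (G : Graph k) → Fin k → ℕ → Set
  DegreeAtLeast {k} G x r =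
    Σ (Fin r → Fin k) λ f → (∀ i j → f i ≡ f j → i ≡ j) × (∀ i → Adj G x (f i))

  degree-iso : ((σ , _) : Iso G H) → DegreeAtLeast G x r → DegreeAtLeast H (σ ⟨$⟩ʳ x) r
  degree-iso {G = G} {H = H} I@(σ , _) (f , f-inj , f-adj) =
    (σ ⟨$⟩ʳ_) ∘ f , (λ i j → f-inj i j ∘ perm-injective σ) , Iso-adj {G = G} {H = H} I ∘ f-adj

  degree-below : (G : Graph k) (L : Vec (Fin k) r) → ∀ {m} → r < m →
                 (∀ y → Adj G x y → y ∈ L) → ¬ DegreeAtLeast G x m
  degree-below G L r<m covered (f , f-inj , f-adj) = collision (Fin.pigeonhole r<m position)
    where
    listed : ∀ i → f i ∈ L
    listed i = covered (f i) (f-adj i)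
    position : Fin _ → Fin _
    position i = Any.index (listed i)
    collision : ¬ ∃ λ i → ∃ λ j → i <ᶠ j × position i ≡ position j
    collision (i , j , i<j , same) = Fin.<⇒≢ i<j (f-inj i j
      (trans (∈⇒lookup (listed i)) (trans (cong (lookup L) same) (sym (∈⇒lookup (listed j))))))

  move-keeps : ((a , b , _) : EdgeMove G G′) → Adj G x y → ¬ SamePair x y a b → Adj G′ x y
  move-keeps {x = x} {y} (_ , _ , _ , _ , _ , _ , _ , G′-adj) xy ¬ab =
    Equivalence.from (G′-adj x y) (inj₁ (xy , ¬ab))

  move-removes : ((a , b , _) : EdgeMove G G′) → SamePair x y a b → ¬ Adj G′ x y
  move-removes {G = G} {x = x} {y} (_ , _ , _ , _ , ab , cd , _ , G′-adj) xy≡ab xy′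
    with Equivalence.to (G′-adj x y) xy′
  ... | inj₁ (_ , ¬ab) = ¬ab xy≡ab
  ... | inj₂ xy≡cd = edge≢non-edge G ab cd (SamePair-trans xy≡ab xy≡cd)

  move-old : ((a , b , c , d , _) : EdgeMove G G′) → Adj G′ x y → ¬ SamePair x y c d → Adj G x y
  move-old {x = x} {y} (_ , _ , _ , _ , _ , _ , _ , G′-adj) xy′ ¬cd with Equivalence.to (G′-adj x y) xy′
  ... | inj₁ (xy , _) = xy
  ... | inj₂ xy≡cd = contradiction xy≡cd ¬cd

  degree-after-move : EdgeMove G G′ → DegreeAtLeast G x (suc r) → DegreeAtLeast G′ x r
  degree-after-move {G = G} {G′ = G′} {x = x} mv@(a , b , _) (f , f-inj , f-adj)
    with Fin.any? (λ i → SamePair? x (f i) a b)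
  ... | yes (i₀ , lost) =
    f ∘ punchIn i₀ , (λ i j → Fin.punchIn-injective i₀ i j ∘ f-inj _ _) ,
    λ i → move-keeps {G = G} {G′ = G′} mv (f-adj (punchIn i₀ i))
            (λ sp → Fin.punchInᵢ≢i i₀ i (f-inj _ _ (SamePair-partner sp lost)))
  ... | no none =
    f ∘ suc , (λ i j → Fin.suc-injective ∘ f-inj _ _) ,
    λ i → move-keeps {G = G} {G′ = G′} mv (f-adj (suc i)) (λ sp → none (suc i , sp))

  ind : Bool → ℕ
  ind u = if u then 1 else 0

  sumᴸ-allFin : (f : Fin k → ℕ) → sumᴸ (map f (allFin k)) ≡ sum f
  sumᴸ-allFin {k} f = trans (cong sumᴸ (map-tabulate (λ i → i) f)) (sum-tabulate f)
    where
    sum-tabulate : ∀ {k} (f : Fin k → ℕ) → sumᴸ (tabulate f) ≡ sum f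
    sum-tabulate {zero} f = refl
    sum-tabulate {suc k} f = cong (f zero +_) (sum-tabulate (f ∘ suc))

  edge-at : (G : Graph k) → Fin k → Fin k → ℕ
  edge-at G i j = ind (adj G i j ∧ (toℕ i <ᵇ toℕ j))

  size-as-sum : (G : Graph k) → size G ≡ sum (λ i → sum (edge-at G i))
  size-as-sum {k} G = trans (sumᴸ-allFin (λ i → sumᴸ (map (edge-at G i) (allFin k))))
                            (sum-cong-≗ (λ i → sumᴸ-allFin (edge-at G i)))

  sum-zero : (f : Fin k → ℕ) → (∀ i → f i ≡ 0) → sum f ≡ 0
  sum-zero {zero} f _ = refl
  sum-zero {suc k} f f≡0 = cong₂ _+_ (f≡0 zero) (sum-zero (f ∘ suc) (f≡0 ∘ suc))

  sum-point : (f : Fin k → ℕ) (p : Fin k) → (∀ i → i ≢ p → f i ≡ 0) → sum f ≡ f p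
  sum-point {suc k} f zero vanish =
    trans (cong (f zero +_) (sum-zero (f ∘ suc) (λ i → vanish (suc i) (λ ())))) (ℕ.+-identityʳ _)
  sum-point {suc k} f (suc p) vanish =
    trans (cong (_+ sum (f ∘ suc)) (vanish zero (λ ())))
          (sum-point (f ∘ suc) p (λ i i≢p → vanish (suc i) (i≢p ∘ Fin.suc-injective)))

  pair-at : (a b : Fin k) → Fin k → Fin k → ℕ
  pair-at a b i j = ind (does (SamePair? i j a b) ∧ (toℕ i <ᵇ toℕ j))

  <ᵇ-true : ∀ {m n} → m < n → (m <ᵇ n) ≡ true
  <ᵇ-true m<n = Equivalence.to Bool.T-≡ (ℕ.<⇒<ᵇ m<n)

  <ᵇ-false : ∀ {m n} → n ≤ m → (m <ᵇ n) ≡ false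
  <ᵇ-false n≤m = not-true (λ t → ℕ.≤⇒≯ n≤m (ℕ.<ᵇ⇒< _ _ (Equivalence.from Bool.T-≡ t)))

  pair-at-off : ∀ {a b i j : Fin k} → ¬ SamePair i j a b → pair-at a b i j ≡ 0
  pair-at-off {a = a} {b} {i} {j} ¬sp = cong (λ u → ind (u ∧ _)) (does-false (SamePair? i j a b) ¬sp)

  pair-at-down : ∀ {a b i j : Fin k} → toℕ j ≤ toℕ i → pair-at a b i j ≡ 0
  pair-at-down {a = a} {b} {i} {j} j≤i =
    trans (cong (λ v → ind (does (SamePair? i j a b) ∧ v)) (<ᵇ-false j≤i)) (cong ind (Bool.∧-zeroʳ _))

  -- A single pair contributes exactly one to the edge count: only the
  -- ordered entry (m, M) with m < M is counted.
  pair-count-ordered : (m M : Fin k) → toℕ m < toℕ M → sum (λ i → sum (pair-at m M i)) ≡ 1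
  pair-count-ordered m M m<M = trans (sum-point _ m off-row) on-row
    where
    off-row : ∀ i → i ≢ m → sum (pair-at m M i) ≡ 0
    off-row i i≢m = sum-zero _ zero-at
      where
      zero-at : ∀ j → pair-at m M i j ≡ 0
      zero-at j with SamePair? i j m M
      ... | no ¬sp = pair-at-off ¬sp
      ... | yes (inj₁ (i≡m , _)) = contradiction i≡m i≢m
      ... | yes (inj₂ (refl , refl)) = pair-at-down (ℕ.<⇒≤ m<M)
    off-column : ∀ j → j ≢ M → pair-at m M m j ≡ 0
    off-column j j≢M with SamePair? m j m M
    ... | no ¬sp = pair-at-off ¬sp
    ... | yes (inj₁ (_ , j≡M)) = contradiction j≡M j≢M
    ... | yes (inj₂ (m≡M , _)) = contradiction (cong toℕ m≡M) (ℕ.<⇒≢ m<M)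
    on-row : sum (pair-at m M m) ≡ 1
    on-row = trans (sum-point _ M off-column)
                   (cong₂ (λ u v → ind (u ∧ v)) (does-true (SamePair? m M m M) SamePair-refl) (<ᵇ-true m<M))

  pair-count : (a b : Fin k) → a ≢ b → sum (λ i → sum (pair-at a b i)) ≡ 1
  pair-count a b a≢b with ℕ.<-cmp (toℕ a) (toℕ b)
  ... | tri< a<b _ _ = pair-count-ordered a b a<b
  ... | tri≈ _ a≡b _ = contradiction (Fin.toℕ-injective a≡b) a≢b
  ... | tri> _ _ b<a = trans (sum-cong-≗ λ i → sum-cong-≗ λ j →
                               cong (λ u → ind (u ∧ (toℕ i <ᵇ toℕ j)))
                                 (does-⇔ (SamePair? i j a b) (SamePair? i j b a) (mk⇔ flip-pair flip-pair)))
                             (pair-count-ordered b a b<a)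
    where
    flip-pair : ∀ {i j u v : Fin _} → SamePair i j u v → SamePair i j v u
    flip-pair (inj₁ p) = inj₂ p
    flip-pair (inj₂ p) = inj₁ p

  move-balance : ((a , b , c , d , _) : EdgeMove G G′) → ∀ x y →
    ind (adj G′ x y) + ind (does (SamePair? x y a b)) ≡ ind (adj G x y) + ind (does (SamePair? x y c d))
  move-balance {G = G} {G′ = G′} mv@(a , b , c , d , ab , cd , _ , G′-adj) x y =
    by-cases (SamePair? x y a b) (SamePair? x y c d)
    where
    by-cases : (ab? : Dec (SamePair x y a b)) (cd? : Dec (SamePair x y c d)) →
               ind (adj G′ x y) + ind (does ab?) ≡ ind (adj G x y) + ind (does cd?)
    by-cases (yes xy≡ab) (yes xy≡cd) = contradiction (SamePair-trans xy≡ab xy≡cd) (edge≢non-edge G ab cd)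
    by-cases (yes xy≡ab) (no _)
      rewrite trans (SamePair-adj G xy≡ab) ab | not-true (move-removes {G = G} {G′ = G′} mv xy≡ab) = refl
    by-cases (no _) (yes xy≡cd)
      rewrite trans (SamePair-adj G xy≡cd) cd | Equivalence.from (G′-adj x y) (inj₂ xy≡cd) = refl
    by-cases (no ¬ab) (no ¬cd) = cong (λ u → ind u + 0)
      (true-ext (λ xy′ → move-old {G = G} {G′ = G′} mv xy′ ¬cd)
                (λ xy → move-keeps {G = G} {G′ = G′} mv xy ¬ab))

  balance-∧ : ∀ {u v u′ v′} L → ind u + ind v ≡ ind u′ + ind v′ →
              ind (u ∧ L) + ind (v ∧ L) ≡ ind (u′ ∧ L) + ind (v′ ∧ L)
  balance-∧ {u} {v} {u′} {v′} false _
    rewrite Bool.∧-zeroʳ u | Bool.∧-zeroʳ v | Bool.∧-zeroʳ u′ | Bool.∧-zeroʳ v′ = refl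
  balance-∧ {u} {v} {u′} {v′} true balanced
    rewrite Bool.∧-identityʳ u | Bool.∧-identityʳ v | Bool.∧-identityʳ u′ | Bool.∧-identityʳ v′ = balanced

  sum₂ : (Fin k → Fin k → ℕ) → ℕ
  sum₂ f = sum (λ i → sum (f i))

  sum₂-distrib : (f g : Fin k → Fin k → ℕ) → sum₂ (λ i j → f i j + g i j) ≡ sum₂ f + sum₂ g
  sum₂-distrib f g = trans (sum-cong-≗ (λ i → ∑-distrib-+ (f i) (g i)))
                           (∑-distrib-+ (λ i → sum (f i)) (λ i → sum (g i)))

  size-move : EdgeMove G G′ → size G ≡ size G′
  size-move {G = G} {G′ = G′} mv@(a , b , c , d , ab , _ , c≢d , _) =
    ℕ.+-cancelʳ-≡ 1 (size G) (size G′) (begin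
      size G + 1
        ≡⟨ cong₂ _+_ (size-as-sum G) (sym (pair-count c d c≢d)) ⟩
      sum₂ (edge-at G) + sum₂ (pair-at c d)
        ≡⟨ sym (sum₂-distrib (edge-at G) (pair-at c d)) ⟩
      sum₂ (λ i j → edge-at G i j + pair-at c d i j)
        ≡⟨ sum-cong-≗ (λ i → sum-cong-≗ λ j → sym (balance i j)) ⟩
      sum₂ (λ i j → edge-at G′ i j + pair-at a b i j)
        ≡⟨ sum₂-distrib (edge-at G′) (pair-at a b) ⟩
      sum₂ (edge-at G′) + sum₂ (pair-at a b)
        ≡⟨ cong₂ _+_ (sym (size-as-sum G′)) (pair-count a b (Adj⇒≢ G ab)) ⟩
      size G′ + 1
        ∎)
    where
    open ≡-Reasoning
    balance : ∀ i j → edge-at G′ i j + pair-at a b i j ≡ edge-at G i j + pair-at c d i j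
    balance i j = balance-∧ {u = adj G′ i j} {v = does (SamePair? i j a b)}
                            {u′ = adj G i j} {v′ = does (SamePair? i j c d)}
                            (toℕ i <ᵇ toℕ j) (move-balance {G = G} {G′ = G′} mv i j)

  Leaf : (G : Graph k) → Fin k → Set
  Leaf {k} G x = Σ (Fin k) λ y → Adj G x y × (∀ z → Adj G x z → z ≡ y)

  record Limb (G : Graph k) (t : ℕ) : Set where
    field
      walk     : ℕ → Fin k
      distinct : ∀ {s s′} → s ≤ t → s′ ≤ t → walk s ≡ walk s′ → s ≡ s′
      steps    : ∀ {s} → s < t → Adj G (walk s) (walk (suc s))
      from-leaf  : Leaf G (walk 0)
      to-branch  : DegreeAtLeast G (walk t) 3

  leaf-iso : ((σ , _) : Iso G H) → Leaf G x → Leaf H (σ ⟨$⟩ʳ x)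
  leaf-iso {G = G} {H = H} {x = x} I@(σ , σ-adj) (y , xy , only-y) =
    σ ⟨$⟩ʳ y , Iso-adj {G = G} {H = H} I xy , λ z σx-z →
      trans (sym (inverseʳ σ)) (cong (σ ⟨$⟩ʳ_) (only-y (σ ⟨$⟩ˡ z)
        (trans (σ-adj x (σ ⟨$⟩ˡ z)) (trans (cong (adj H _) (inverseʳ σ)) σx-z))))

  limb-iso : ∀ {t} → Iso G H → Limb G t → Limb H t
  limb-iso {G = G} {H = H} I@(σ , _) limb = record
    { walk     = (σ ⟨$⟩ʳ_) ∘ walk
    ; distinct = λ s≤t s′≤t → distinct s≤t s′≤t ∘ perm-injective σ
    ; steps    = Iso-adj {G = G} {H = H} I ∘ steps
    ; from-leaf = leaf-iso {G = G} {H = H} I from-leaf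
    ; to-branch = degree-iso {G = G} {H = H} I to-branch
    }
    where open Limb limb

open GraphFacts

-- Graphs induced by symmetric relations on ℕ

module InducedGraphs where
  open import Data.Vec using (map)
  open import Data.Vec.Membership.Propositional using (_∈_)
  open import Data.Vec.Membership.Propositional.Properties using (∈-map⁺)

  private variable
    k m r : ℕ
    a b p q : ℕ

  record SymRel : Set₁ where
    field
      E     : ℕ → ℕ → Set
      E?    : ∀ a b → Dec (E a b)
      E-sym : ∀ {a b} → E a b → E b a
      E-irr : ∀ {a} → ¬ E a a
  open SymRel

  graphOf : (k : ℕ) → SymRel → Graph k
  graphOf k R = record
    { adj    = λ x y → does (E? R (toℕ x) (toℕ y))
    ; sym    = λ x y → does-⇔ (E? R _ _) (E? R _ _) (mk⇔ (E-sym R) (E-sym R))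
    ; irrefl = λ x → does-false (E? R _ _) (E-irr R)
    }

  Adj-graphOf : (R : SymRel) {x y : Fin k} → Adj (graphOf k R) x y ⇔ E R (toℕ x) (toℕ y)
  Adj-graphOf R = mk⇔ (does-sound (E? R _ _)) (does-true (E? R _ _))

  infixl 6 _∪_
  _∪_ : SymRel → SymRel → SymRel
  R ∪ S = record
    { E     = λ a b → E R a b ⊎ E S a b
    ; E?    = λ a b → E? R a b ⊎-dec E? S a b
    ; E-sym = λ { (inj₁ ab) → inj₁ (E-sym R ab) ; (inj₂ ab) → inj₂ (E-sym S ab) }
    ; E-irr = λ { (inj₁ aa) → E-irr R aa ; (inj₂ aa) → E-irr S aa }
    }

  ∅ : SymRel
  ∅ = record { E = λ _ _ → ⊥ ; E? = λ _ _ → no λ () ; E-sym = λ () ; E-irr = λ () }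

  Pair : ℕ → ℕ → ℕ → ℕ → Set
  Pair p q a b = (a ≡ p × b ≡ q) ⊎ (a ≡ q × b ≡ p)

  pair : (p q : ℕ) → p ≢ q → SymRel
  pair p q p≢q = record
    { E     = Pair p q
    ; E?    = λ a b → ((a ℕ.≟ p) ×-dec (b ℕ.≟ q)) ⊎-dec ((a ℕ.≟ q) ×-dec (b ℕ.≟ p))
    ; E-sym = λ { (inj₁ (a≡p , b≡q)) → inj₂ (b≡q , a≡p) ; (inj₂ (a≡q , b≡p)) → inj₁ (b≡p , a≡q) }
    ; E-irr = λ { (inj₁ (refl , refl)) → p≢q refl ; (inj₂ (refl , refl)) → p≢q refl }
    }

  Pair-edge : (R : SymRel) → Pair p q a b → E R a b → E R p q
  Pair-edge R (inj₁ (refl , refl)) ab = ab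
  Pair-edge R (inj₂ (refl , refl)) ab = E-sym R ab

  Step : ℕ → ℕ → ℕ → Set
  Step N a b = suc a ≡ b × b < N

  path : ℕ → SymRel
  path N = record
    { E     = λ a b → Step N a b ⊎ Step N b a
    ; E?    = λ a b → step? a b ⊎-dec step? b a
    ; E-sym = λ { (inj₁ ab) → inj₂ ab ; (inj₂ ba) → inj₁ ba }
    ; E-irr = λ { (inj₁ (a+1≡a , _)) → ℕ.1+n≢n a+1≡a ; (inj₂ (a+1≡a , _)) → ℕ.1+n≢n a+1≡a }
    }
    where
    step? : ∀ a b → Dec (Step N a b)
    step? a b = (suc a ℕ.≟ b) ×-dec (b ℕ.<? N)

  path-below : ∀ {N a b} → E (path N) a b → a < N × b < N
  path-below (inj₁ (refl , a+1<N)) = ℕ.<-trans (ℕ.n<1+n _) a+1<N , a+1<N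
  path-below (inj₂ (refl , b+1<N)) = b+1<N , ℕ.<-trans (ℕ.n<1+n _) b+1<N

  -- The vertex with number a (meaningful for a ≤ k); numbering is injective and
  -- inverse to toℕ.
  vertex : ℕ → Fin (suc k)
  vertex {k} a with a ℕ.<? suc k
  ... | yes a<k = fromℕ< a<k
  ... | no _ = zero

  toℕ-vertex : a < suc k → toℕ (vertex {k} a) ≡ a
  toℕ-vertex {a} {k} a<k with a ℕ.<? suc k
  ... | yes a<k′ = Fin.toℕ-fromℕ< a<k′
  ... | no a≮k = contradiction a<k a≮k

  vertex-toℕ : (x : Fin (suc k)) → vertex (toℕ x) ≡ x
  vertex-toℕ x = Fin.toℕ-injective (toℕ-vertex (Fin.toℕ<n x))

  vertex-injective : a < suc k → b < suc k → vertex {k} a ≡ vertex b → a ≡ b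
  vertex-injective a<k b<k eq = trans (sym (toℕ-vertex a<k)) (trans (cong toℕ eq) (toℕ-vertex b<k))

  named : (x : Fin (suc k)) → toℕ x ≡ b → x ≡ vertex b
  named x refl = sym (vertex-toℕ x)

  SamePair-vertex : ∀ {x y : Fin (suc k)} → p < suc k → q < suc k →
    SamePair x y (vertex p) (vertex q) ⇔ Pair p q (toℕ x) (toℕ y)
  SamePair-vertex p<k q<k = mk⇔
    (λ { (inj₁ (refl , refl)) → inj₁ (toℕ-vertex p<k , toℕ-vertex q<k)
       ; (inj₂ (refl , refl)) → inj₂ (toℕ-vertex q<k , toℕ-vertex p<k) })
    (λ { (inj₁ (x≡p , y≡q)) → inj₁ (named _ x≡p , named _ y≡q)
       ; (inj₂ (x≡q , y≡p)) → inj₂ (named _ x≡q , named _ y≡p) })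

  Adj-vertex : (R : SymRel) {x : Fin (suc k)} → b < suc k →
               E R (toℕ x) b → Adj (graphOf (suc k) R) x (vertex b)
  Adj-vertex R b<k e = Equivalence.from (Adj-graphOf R) (subst (E R _) (sym (toℕ-vertex b<k)) e)

  Adj-vertices : (R : SymRel) → a < suc k → b < suc k →
                 E R a b → Adj (graphOf (suc k) R) (vertex a) (vertex b)
  Adj-vertices R a<k b<k e = Adj-vertex R b<k (subst (λ a → E R a _) (sym (toℕ-vertex a<k)) e)

  Adj-from-vertex : (R : SymRel) {z : Fin (suc k)} → a < suc k →
                    Adj (graphOf (suc k) R) (vertex a) z → E R a (toℕ z)
  Adj-from-vertex R a<k xz = subst (λ a → E R a _) (toℕ-vertex a<k) (Equivalence.to (Adj-graphOf R) xz)

  pair-move : ∀ {k p q p′ q′} (R R′ Base : SymRel) →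
    p < suc k → q < suc k → p′ < suc k → q′ < suc k →
    (∀ {a b} → E R a b ⇔ (E Base a b ⊎ Pair p q a b)) →
    (∀ {a b} → E R′ a b ⇔ (E Base a b ⊎ Pair p′ q′ a b)) →
    ¬ E Base p q → ¬ E R p′ q′ → EdgeMove (graphOf (suc k) R) (graphOf (suc k) R′)
  pair-move {k} {p} {q} {p′} {q′} R R′ Base p<k q<k p′<k q′<k R⇔ R′⇔ ¬Base-pq ¬R-p′q′ =
    vertex p , vertex q , vertex p′ , vertex q′ ,
    does-true (E? R _ _) (subst₂ (E R) (sym (toℕ-vertex p<k)) (sym (toℕ-vertex q<k)) R-pq) ,
    does-false (E? R _ _)
      (subst₂ (λ a b → ¬ E R a b) (sym (toℕ-vertex p′<k)) (sym (toℕ-vertex q′<k)) ¬R-p′q′) ,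
    (λ eq → E-irr R′ (subst (E R′ p′) (sym (vertex-injective p′<k q′<k eq)) R′-p′q′)) ,
    λ x y → mk⇔ to (from {x} {y})
    where
    R-pq : E R p q
    R-pq = Equivalence.from R⇔ (inj₂ (inj₁ (refl , refl)))
    R′-p′q′ : E R′ p′ q′
    R′-p′q′ = Equivalence.from R′⇔ (inj₂ (inj₁ (refl , refl)))
    G  = graphOf (suc k) R
    G′ = graphOf (suc k) R′
    Moved-pq : Fin (suc k) → Fin (suc k) → Set
    Moved-pq = Moved G (vertex p) (vertex q) (vertex p′) (vertex q′)
    to : ∀ {x y} → Adj G′ x y → Moved-pq x y
    to xy′ with Equivalence.to R′⇔ (Equivalence.to (Adj-graphOf R′) xy′)
    ... | inj₁ base = inj₁ (Equivalence.from (Adj-graphOf R) (Equivalence.from R⇔ (inj₁ base)) ,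
                            λ sp → ¬Base-pq
                                     (Pair-edge Base (Equivalence.to (SamePair-vertex p<k q<k) sp) base))
    ... | inj₂ new = inj₂ (Equivalence.from (SamePair-vertex p′<k q′<k) new)
    from : ∀ {x y} → Moved-pq x y → Adj G′ x y
    from (inj₂ sp) = Equivalence.from (Adj-graphOf R′)
                       (Equivalence.from R′⇔ (inj₂ (Equivalence.to (SamePair-vertex p′<k q′<k) sp)))
    from (inj₁ (xy , ¬sp)) with Equivalence.to R⇔ (Equivalence.to (Adj-graphOf R) xy)
    ... | inj₁ base = Equivalence.from (Adj-graphOf R′) (Equivalence.from R′⇔ (inj₁ base))
    ... | inj₂ old = contradiction (Equivalence.from (SamePair-vertex p<k q<k) old) ¬sp

  degree-at-least : (R : SymRel) → a < suc k → (f : Fin r → ℕ) →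
    (∀ i j → f i ≡ f j → i ≡ j) → (∀ i → f i < suc k) → (∀ i → E R a (f i)) →
    DegreeAtLeast (graphOf (suc k) R) (vertex a) r
  degree-at-least R a<k f f-inj f<k f-adj =
    vertex ∘ f , (λ i j → f-inj i j ∘ vertex-injective (f<k i) (f<k j)) ,
    λ i → Adj-vertices R a<k (f<k i) (f-adj i)

  Cover : SymRel → ℕ → Vec ℕ m → Set
  Cover R a L = ∀ {b} → E R a b → b ∈ L

  degree-below-cover : (R : SymRel) {x : Fin (suc k)} (L : Vec ℕ m) → m < r →
    Cover R (toℕ x) L → ¬ DegreeAtLeast (graphOf (suc k) R) x r
  degree-below-cover {k = k} R {x} L m<r cover =
    degree-below {x = x} (graphOf (suc k) R) (map vertex L) m<r λ y xy →
      subst (_∈ map vertex L) (vertex-toℕ y) (∈-map⁺ vertex (cover (Equivalence.to (Adj-graphOf R) xy)))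

  relabel-iso : (R R′ : SymRel) (ρ : ℕ → ℕ) → (∀ a → ρ (ρ a) ≡ a) →
    (∀ {a} → a < suc k → ρ a < suc k) → (∀ a b → E R (ρ a) (ρ b) ⇔ E R′ a b) →
    Iso (graphOf (suc k) R′) (graphOf (suc k) R)
  relabel-iso {k} R R′ ρ ρρ ρ<k ρ-edges =
    Perm.permutation σ σ σσ σσ , λ x y →
      does-⇔ (E? R′ _ _) (E? R _ _)
        (mk⇔ (subst₂ (E R) (sym (toℕ-σ x)) (sym (toℕ-σ y)) ∘ Equivalence.from (ρ-edges _ _))
             (Equivalence.to (ρ-edges _ _) ∘ subst₂ (E R) (toℕ-σ x) (toℕ-σ y)))
    where
    σ : Fin (suc k) → Fin (suc k)
    σ x = vertex (ρ (toℕ x))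
    toℕ-σ : ∀ x → toℕ (σ x) ≡ ρ (toℕ x)
    toℕ-σ x = toℕ-vertex (ρ<k (Fin.toℕ<n x))
    σσ : ∀ x → σ (σ x) ≡ x
    σσ x = Fin.toℕ-injective (trans (toℕ-σ (σ x)) (trans (cong ρ (toℕ-σ x)) (ρρ (toℕ x))))

open InducedGraphs
open SymRel

-- The construction

-- The family for K_n minus an edge, n = n′ + 1 ≥ 5.  Vertices are numbered:
-- a path 0 — 1 — ⋯ — last on N = 2n vertices, a pendant vertex w = N,
-- a star centre c = N + 1 and star leaves leaf i = N + 2 + i (i < 5).
module Construction (n′ : ℕ) (4≤n′ : 4 ≤ n′) where
  open import Data.Vec.Relation.Unary.Any using (here; there)
  open import Data.Vec.Membership.Propositional using (_∈_)

  n last N w c K : ℕ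
  n = suc n′
  last = n′ + n
  N = suc last
  w = N
  c = N + 1
  K = N + 6

  leaf : ℕ → ℕ
  leaf i = N + (2 + i)

  Vertex : Set
  Vertex = Fin (suc K)

  5≤n : 5 ≤ n
  5≤n = s≤s 4≤n′

  n<N : n < N
  n<N = ℕ.m<m+n n (ℕ.<-≤-trans (s≤s z≤n) 5≤n)

  9≤last : 9 ≤ last
  9≤last = ℕ.+-mono-≤ 4≤n′ 5≤n

  ≤N⇒vertex : ∀ {a} → a ≤ N → a < suc K
  ≤N⇒vertex a≤N = s≤s (ℕ.≤-trans a≤N (ℕ.m≤m+n N 6))

  <N⇒vertex : ∀ {a} → a < N → a < suc K
  <N⇒vertex = ≤N⇒vertex ∘ ℕ.<⇒≤

  c-vertex : c < suc K
  c-vertex = s≤s (ℕ.+-monoʳ-≤ N (s≤s z≤n))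

  leaf-vertex : ∀ {i} → i ≤ 4 → leaf i < suc K
  leaf-vertex i≤4 = s≤s (ℕ.+-monoʳ-≤ N (s≤s (s≤s i≤4)))

  N<N+ : ∀ {t} → 0 < t → N < N + t
  N<N+ = ℕ.m<m+n N

  N<c : N < c
  N<c = N<N+ (s≤s z≤n)

  N<leaf : ∀ i → N < leaf i
  N<leaf i = N<N+ (s≤s z≤n)

  c≢leaf : ∀ i → c ≢ leaf i
  c≢leaf i eq with ℕ.+-cancelˡ-≡ N 1 (2 + i) eq
  ... | ()

  leaf-injective : ∀ {i i′} → leaf i ≡ leaf i′ → i ≡ i′
  leaf-injective eq = ℕ.suc-injective (ℕ.suc-injective (ℕ.+-cancelˡ-≡ N _ _ eq))

  <N⇒≢ : ∀ {a b} → a < N → N ≤ b → a ≢ b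
  <N⇒≢ a<N N≤b refl = ℕ.<⇒≱ a<N N≤b

  0≢last : 0 ≢ last
  0≢last eq = ℕ.<⇒≢ (ℕ.<-≤-trans (s≤s z≤n) 9≤last) eq

  record Spot (j : ℕ) : Set where
    constructor spot
    field
      2≤j : 2 ≤ j
      j<n : j < n

    j<N : j < N
    j<N = ℕ.<-trans j<n n<N

    j+1<N : suc j < N
    j+1<N = ℕ.<-≤-trans (s≤s j<n) n<N

  star : ℕ → SymRel
  star zero = ∅
  star (suc r) = star r ∪ pair c (leaf r) (c≢leaf r)

  StarEdge : ℕ → ℕ → ℕ → Set
  StarEdge r a b = a ≡ c × Σ ℕ λ i → i < r × b ≡ leaf i

  star-view : ∀ {r a b} → E (star r) a b → StarEdge r a b ⊎ StarEdge r b a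
  star-view {suc r} (inj₁ e) with star-view {r} e
  ... | inj₁ (a≡c , i , i<r , b≡l) = inj₁ (a≡c , i , ℕ.m≤n⇒m≤1+n i<r , b≡l)
  ... | inj₂ (b≡c , i , i<r , a≡l) = inj₂ (b≡c , i , ℕ.m≤n⇒m≤1+n i<r , a≡l)
  star-view {suc r} (inj₂ (inj₁ (a≡c , b≡l))) = inj₁ (a≡c , r , ℕ.≤-refl , b≡l)
  star-view {suc r} (inj₂ (inj₂ (a≡l , b≡c))) = inj₂ (b≡c , r , ℕ.≤-refl , a≡l)

  star-edge : ∀ {r i} → i < r → E (star r) c (leaf i)
  star-edge {suc r} {i} i<r with i ℕ.≟ r
  ... | yes refl = inj₂ (inj₁ (refl , refl))
  ... | no i≢r = inj₁ (star-edge (ℕ.≤∧≢⇒< (ℕ.≤-pred i<r) i≢r))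

  not-star-edge : ∀ {r i} → r ≤ i → ¬ E (star r) c (leaf i)
  not-star-edge {r} {i} r≤i e with star-view {r} {c} {leaf i} e
  ... | inj₁ (_ , i′ , i′<r , l≡l′) = ℕ.<⇒≱ i′<r (subst (_ ≤_) (leaf-injective l≡l′) r≤i)
  ... | inj₂ (l≡c , _) = c≢leaf _ (sym l≡c)

  star-above : ∀ {r a b} → E (star r) a b → N < a × N < b
  star-above {r} {a} {b} e with star-view {r} {a} {b} e
  ... | inj₁ (refl , i , _ , refl) = N<c , N<leaf i
  ... | inj₂ (refl , i , _ , refl) = N<leaf i , N<c

  cycle : SymRel
  cycle = path N ∪ pair 0 last 0≢last

  pendant : ∀ {j} → Spot j → SymRel
  pendant {j} sj = pair j w (<N⇒≢ (Spot.j<N sj) ℕ.≤-refl)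

  RU : SymRel
  RU = path N ∪ star 5

  RM RT : ∀ {j} → Spot j → SymRel
  RM sj = path N ∪ star 4 ∪ pendant sj
  RT sj = cycle ∪ star 3 ∪ pendant sj

  spot2 : Spot 2
  spot2 = spot ℕ.≤-refl (ℕ.<-≤-trans (s≤s (s≤s (s≤s z≤n))) 5≤n)

  U V : Graph (suc K)
  U = graphOf (suc K) RU
  V = graphOf (suc K) (RT spot2)

  M T : ∀ {j} → Spot j → Graph (suc K)
  M sj = graphOf (suc K) (RM sj)
  T sj = graphOf (suc K) (RT sj)

  not-path-high : ∀ {a b} → N ≤ b → ¬ E (path N) a b
  not-path-high {a} {b} N≤b e = ℕ.<⇒≱ (proj₂ (path-below {N} {a} {b} e)) N≤b

  not-star-low : ∀ {r a b} → b ≤ N → ¬ E (star r) a b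
  not-star-low {r} {a} {b} b≤N e = ℕ.<⇒≱ (proj₂ (star-above {r} {a} {b} e)) b≤N

  not-pendant : ∀ {j j′} (sj : Spot j) → Spot j′ → j ≢ j′ → ¬ E (RM sj) j′ w
  not-pendant {j′ = j′} sj sj′ j≢j′ (inj₁ (inj₁ e)) = not-path-high {j′} ℕ.≤-refl e
  not-pendant {j′ = j′} sj sj′ j≢j′ (inj₁ (inj₂ e)) = not-star-low {4} {j′} ℕ.≤-refl e
  not-pendant sj sj′ j≢j′ (inj₂ (inj₁ (j′≡j , _))) = j≢j′ (sym j′≡j)
  not-pendant sj sj′ j≢j′ (inj₂ (inj₂ (j′≡w , _))) = <N⇒≢ (Spot.j<N sj′) ℕ.≤-refl j′≡w

  not-pendant-base : ∀ {j r} → Spot j → ¬ E (path N ∪ star r) j w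
  not-pendant-base {j} sj (inj₁ e) = not-path-high {j} ℕ.≤-refl e
  not-pendant-base {j} {r} sj (inj₂ e) = not-star-low {r} {j} ℕ.≤-refl e

  pendant-low : ∀ {j a b} (sj : Spot j) → E (pendant sj) a b → a ≤ N
  pendant-low sj (inj₁ (refl , _)) = ℕ.<⇒≤ (Spot.j<N sj)
  pendant-low sj (inj₂ (refl , _)) = ℕ.≤-refl

  not-c-edge-M : ∀ {j i} (sj : Spot j) → 4 ≤ i → ¬ E (RM sj) c (leaf i)
  not-c-edge-M {i = i} sj 4≤i (inj₁ (inj₁ e)) = not-path-high {c} (ℕ.<⇒≤ (N<leaf i)) e
  not-c-edge-M sj 4≤i (inj₁ (inj₂ e)) = not-star-edge 4≤i e
  not-c-edge-M sj 4≤i (inj₂ e) = ℕ.<⇒≱ N<c (pendant-low sj e)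

  not-closing-M : ∀ {j} (sj : Spot j) → ¬ E (RM sj) 0 last
  not-closing-M sj (inj₁ (inj₁ (inj₁ (1≡last , _)))) = ℕ.<⇒≢ (ℕ.<-≤-trans (s≤s (s≤s z≤n)) 9≤last) 1≡last
  not-closing-M sj (inj₁ (inj₁ (inj₂ (()  , _))))
  not-closing-M sj (inj₁ (inj₂ e)) = not-star-low {4} {last} z≤n (E-sym (star 4) e)
  not-closing-M sj (inj₂ (inj₁ (0≡j , _))) = ℕ.<⇒≢ (ℕ.<-≤-trans (s≤s z≤n) (Spot.2≤j sj)) 0≡j
  not-closing-M sj (inj₂ (inj₂ (0≡w , _))) = ℕ.0≢1+n 0≡w

  move-MM : ∀ {j j′} (sj : Spot j) (sj′ : Spot j′) → j ≢ j′ → EdgeMove (M sj) (M sj′)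
  move-MM sj sj′ j≢j′ =
    pair-move (RM sj) (RM sj′) (path N ∪ star 4)
      (<N⇒vertex (Spot.j<N sj)) (≤N⇒vertex ℕ.≤-refl) (<N⇒vertex (Spot.j<N sj′)) (≤N⇒vertex ℕ.≤-refl)
      (mk⇔ id id) (mk⇔ id id) (not-pendant-base {r = 4} sj) (not-pendant sj sj′ j≢j′)

  move-MU : ∀ {j} (sj : Spot j) → EdgeMove (M sj) U
  move-MU sj =
    pair-move (RM sj) RU (path N ∪ star 4)
      (<N⇒vertex (Spot.j<N sj)) (≤N⇒vertex ℕ.≤-refl) c-vertex (leaf-vertex ℕ.≤-refl)
      (mk⇔ id id) (mk⇔ assocˡ assocʳ) (not-pendant-base {r = 4} sj) (not-c-edge-M sj ℕ.≤-refl)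

  -- M j → T j: move the fourth star edge to the edge closing the cycle
  move-MT : ∀ {j} (sj : Spot j) → EdgeMove (M sj) (T sj)
  move-MT sj =
    pair-move (RM sj) (RT sj) (path N ∪ star 3 ∪ pendant sj)
      c-vertex (leaf-vertex (ℕ.n≤1+n 3)) (≤N⇒vertex z≤n) (<N⇒vertex (ℕ.n<1+n last))
      (mk⇔ M→ M←) (mk⇔ T→ T←) not-base (not-closing-M sj)
    where
    M→ : ∀ {a b} → E (RM sj) a b → E (path N ∪ star 3 ∪ pendant sj) a b ⊎ Pair c (leaf 3) a b
    M→ (inj₁ (inj₁ p)) = inj₁ (inj₁ (inj₁ p))
    M→ (inj₁ (inj₂ (inj₁ s))) = inj₁ (inj₁ (inj₂ s))
    M→ (inj₁ (inj₂ (inj₂ e))) = inj₂ e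
    M→ (inj₂ e) = inj₁ (inj₂ e)
    M← : ∀ {a b} → E (path N ∪ star 3 ∪ pendant sj) a b ⊎ Pair c (leaf 3) a b → E (RM sj) a b
    M← (inj₁ (inj₁ (inj₁ p))) = inj₁ (inj₁ p)
    M← (inj₁ (inj₁ (inj₂ s))) = inj₁ (inj₂ (inj₁ s))
    M← (inj₁ (inj₂ e)) = inj₂ e
    M← (inj₂ e) = inj₁ (inj₂ (inj₂ e))
    T→ : ∀ {a b} → E (RT sj) a b → E (path N ∪ star 3 ∪ pendant sj) a b ⊎ Pair 0 last a b
    T→ (inj₁ (inj₁ (inj₁ p))) = inj₁ (inj₁ (inj₁ p))
    T→ (inj₁ (inj₁ (inj₂ e))) = inj₂ e
    T→ (inj₁ (inj₂ s)) = inj₁ (inj₁ (inj₂ s))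
    T→ (inj₂ e) = inj₁ (inj₂ e)
    T← : ∀ {a b} → E (path N ∪ star 3 ∪ pendant sj) a b ⊎ Pair 0 last a b → E (RT sj) a b
    T← (inj₁ (inj₁ (inj₁ p))) = inj₁ (inj₁ (inj₁ p))
    T← (inj₁ (inj₁ (inj₂ s))) = inj₁ (inj₂ s)
    T← (inj₁ (inj₂ e)) = inj₂ e
    T← (inj₂ e) = inj₁ (inj₁ (inj₂ e))
    not-base : ¬ E (path N ∪ star 3 ∪ pendant sj) c (leaf 3)
    not-base (inj₁ (inj₁ p)) = not-path-high {c} (ℕ.<⇒≤ (N<leaf 3)) p
    not-base (inj₁ (inj₂ s)) = not-star-edge {3} {3} ℕ.≤-refl s
    not-base (inj₂ e) = ℕ.<⇒≱ N<c (pendant-low sj e)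

  path-neighbours : ∀ {a b} → E (path N) a b → suc b ≡ a ⊎ (b ≡ suc a × b < N)
  path-neighbours (inj₁ (a+1≡b , b<N)) = inj₂ (sym a+1≡b , b<N)
  path-neighbours (inj₂ (b+1≡a , _)) = inj₁ b+1≡a

  star-neighbours-c : ∀ {r b} → E (star r) c b → Σ ℕ λ i → i < r × b ≡ leaf i
  star-neighbours-c {r} {b} e with star-view {r} {c} {b} e
  ... | inj₁ (_ , i , i<r , b≡leaf) = i , i<r , b≡leaf
  ... | inj₂ (_ , i , _ , c≡leaf) = contradiction c≡leaf (c≢leaf i)

  star-neighbours-other : ∀ {r a b} → a ≢ c → E (star r) a b → b ≡ c
  star-neighbours-other {r} {a} {b} a≢c e with star-view {r} {a} {b} e
  ... | inj₁ (a≡c , _) = contradiction a≡c a≢c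
  ... | inj₂ (b≡c , _) = b≡c

  leaves : (r : ℕ) → Vec ℕ r
  leaves zero = []
  leaves (suc r) = leaf r ∷ leaves r

  leaf∈leaves : ∀ {r i} → i < r → leaf i ∈ leaves r
  leaf∈leaves {suc r} {i} i<r with i ℕ.≟ r
  ... | yes refl = here refl
  ... | no i≢r = there (leaf∈leaves (ℕ.≤∧≢⇒< (ℕ.≤-pred i<r) i≢r))

  data Region (a : ℕ) : Set where
    on-path : a < N → Region a
    at-w    : a ≡ w → Region a
    at-c    : a ≡ c → Region a
    above   : N < a → a ≢ c → Region a

  region : ∀ a → Region a
  region a with ℕ.<-cmp a N
  ... | tri< a<N _ _ = on-path a<N
  ... | tri≈ _ a≡N _ = at-w a≡N
  ... | tri> _ _ N<a with a ℕ.≟ c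
  ...   | yes a≡c = at-c a≡c
  ...   | no a≢c = above N<a a≢c

  cycle-below : ∀ {a b} → E cycle a b → a < N × b < N
  cycle-below {a} {b} (inj₁ p) = path-below {N} {a} {b} p
  cycle-below (inj₂ (inj₁ (refl , refl))) = s≤s z≤n , ℕ.n<1+n last
  cycle-below (inj₂ (inj₂ (refl , refl))) = ℕ.n<1+n last , s≤s z≤n

  -- Neighbourhoods in a graph "X + r-star + pendant at j" where X lives below N
  -- (X is the path for M j and the cycle for T j).
  module Shape {j} (sj : Spot j) (X : SymRel) (X-below : ∀ {a b} → E X a b → a < N × b < N) (r : ℕ) where
    R : SymRel
    R = X ∪ star r ∪ pendant sj

    w-neighbours : ∀ {b} → E R w b → b ≡ j
    w-neighbours (inj₁ (inj₁ x)) = contradiction (proj₁ (X-below x)) (ℕ.n≮n N)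
    w-neighbours {b} (inj₁ (inj₂ s)) = contradiction (proj₁ (star-above {r} {w} {b} s)) (ℕ.n≮n N)
    w-neighbours (inj₂ (inj₁ (w≡j , _))) = contradiction (sym w≡j) (<N⇒≢ (Spot.j<N sj) ℕ.≤-refl)
    w-neighbours (inj₂ (inj₂ (_ , b≡j))) = b≡j

    c-neighbours : ∀ {b} → E R c b → Σ ℕ λ i → i < r × b ≡ leaf i
    c-neighbours (inj₁ (inj₁ x)) = contradiction (proj₁ (X-below x)) (ℕ.<⇒≯ N<c)
    c-neighbours (inj₁ (inj₂ s)) = star-neighbours-c {r} s
    c-neighbours (inj₂ e) = contradiction (pendant-low sj e) (ℕ.<⇒≱ N<c)

    high-neighbours : ∀ {a b} → N < a → a ≢ c → E R a b → b ≡ c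
    high-neighbours N<a _ (inj₁ (inj₁ x)) = contradiction (proj₁ (X-below x)) (ℕ.<⇒≯ N<a)
    high-neighbours _ a≢c (inj₁ (inj₂ s)) = star-neighbours-other {r} a≢c s
    high-neighbours N<a _ (inj₂ e) = contradiction (pendant-low sj e) (ℕ.<⇒≱ N<a)

    low-neighbours : ∀ {a b} → a < N → E R a b → E X a b ⊎ (a ≡ j × b ≡ w)
    low-neighbours _ (inj₁ (inj₁ x)) = inj₁ x
    low-neighbours {a} {b} a<N (inj₁ (inj₂ s)) = contradiction (proj₁ (star-above {r} {a} {b} s)) (ℕ.<⇒≯ a<N)
    low-neighbours _ (inj₂ (inj₁ jw)) = inj₂ jw
    low-neighbours a<N (inj₂ (inj₂ (a≡w , _))) = contradiction a≡w (<N⇒≢ a<N ℕ.≤-refl)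

    high-cover : ∀ {a} → N < a → a ≢ c → Cover R a (c ∷ [])
    high-cover N<a a≢c e = here (high-neighbours N<a a≢c e)

    w-cover : Cover R w (j ∷ [])
    w-cover e = here (w-neighbours e)

    c-cover : Cover R c (leaves r)
    c-cover e with c-neighbours e
    ... | i , i<r , refl = leaf∈leaves i<r

    degree-single : ∀ {x : Vertex} {m} → 1 < m → toℕ x ≡ w ⊎ (N < toℕ x × toℕ x ≢ c) →
                    ¬ DegreeAtLeast (graphOf (suc K) R) x m
    degree-single 1<m (inj₁ x≡w) =
      degree-below-cover R (j ∷ []) 1<m (subst (λ a → Cover R a (j ∷ [])) (sym x≡w) w-cover)
    degree-single 1<m (inj₂ (N<x , x≢c)) = degree-below-cover R (c ∷ []) 1<m (high-cover N<x x≢c)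

    degree-centre : ∀ {x : Vertex} {m} → r < m → toℕ x ≡ c → ¬ DegreeAtLeast (graphOf (suc K) R) x m
    degree-centre r<m x≡c =
      degree-below-cover R (leaves r) r<m (subst (λ a → Cover R a (leaves r)) (sym x≡c) c-cover)

    centre-degree : r ≤ 5 → DegreeAtLeast (graphOf (suc K) R) (vertex c) r
    centre-degree r≤5 =
      degree-at-least R c-vertex (leaf ∘ toℕ)
        (λ i i′ → Fin.toℕ-injective ∘ leaf-injective)
        (λ i → leaf-vertex (ℕ.≤-pred (ℕ.≤-trans (Fin.toℕ<n i) r≤5)))
        (λ i → inj₁ (inj₂ (star-edge (Fin.toℕ<n i))))

  U-centre : DegreeAtLeast U (vertex c) 5
  U-centre =
    degree-at-least RU c-vertex (leaf ∘ toℕ)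
      (λ i i′ → Fin.toℕ-injective ∘ leaf-injective)
      (λ i → leaf-vertex (ℕ.≤-pred (Fin.toℕ<n i)))
      (λ i → inj₂ (star-edge (Fin.toℕ<n i)))

  module M-degrees {j} (sj : Spot j) where
    open Shape sj (path N) (λ {a} {b} → path-below {N} {a} {b}) 4

    path-cover : ∀ {a} → a < N → Cover (RM sj) a (pred a ∷ suc a ∷ w ∷ [])
    path-cover a<N e with low-neighbours a<N e
    ... | inj₁ p with path-neighbours p
    ...   | inj₁ b+1≡a = here (cong pred b+1≡a)
    ...   | inj₂ (b≡a+1 , _) = there (here b≡a+1)
    path-cover a<N e | inj₂ (_ , b≡w) = there (there (here b≡w))

    interior-cover : ∀ {a} → a < N → a ≢ j → Cover (RM sj) a (pred a ∷ suc a ∷ [])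
    interior-cover a<N a≢j e with low-neighbours a<N e
    ... | inj₁ p with path-neighbours p
    ...   | inj₁ b+1≡a = here (cong pred b+1≡a)
    ...   | inj₂ (b≡a+1 , _) = there (here b≡a+1)
    interior-cover a<N a≢j e | inj₂ (a≡j , _) = contradiction a≡j a≢j

    M-degree<5 : ∀ x → ¬ DegreeAtLeast (M sj) x 5
    M-degree<5 x with region (toℕ x)
    ... | on-path x<N = degree-below-cover (RM sj) _ (s≤s (s≤s (s≤s (s≤s z≤n)))) (path-cover x<N)
    ... | at-w x≡w = degree-single (s≤s (s≤s z≤n)) (inj₁ x≡w)
    ... | at-c x≡c = degree-centre ℕ.≤-refl x≡c
    ... | above N<x x≢c = degree-single (s≤s (s≤s z≤n)) (inj₂ (N<x , x≢c))

    M-branch : ∀ x → DegreeAtLeast (M sj) x 3 → toℕ x ≡ j ⊎ toℕ x ≡ c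
    M-branch x deg with region (toℕ x)
    ... | at-c x≡c = inj₂ x≡c
    ... | at-w x≡w = contradiction deg (degree-single (s≤s (s≤s z≤n)) (inj₁ x≡w))
    ... | above N<x x≢c = contradiction deg (degree-single (s≤s (s≤s z≤n)) (inj₂ (N<x , x≢c)))
    ... | on-path x<N with toℕ x ℕ.≟ j
    ...   | yes x≡j = inj₁ x≡j
    ...   | no x≢j = contradiction deg (degree-below-cover (RM sj) _ ℕ.≤-refl (interior-cover x<N x≢j))

    M-centre : DegreeAtLeast (M sj) (vertex c) 4
    M-centre = centre-degree (ℕ.n≤1+n 4)

  module T-degrees {j} (sj : Spot j) where
    open Shape sj cycle cycle-below 3

    cover-0 : Cover (RT sj) 0 (last ∷ 1 ∷ w ∷ [])
    cover-0 e with low-neighbours (s≤s z≤n) e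
    ... | inj₁ (inj₁ p) with path-neighbours p
    ...   | inj₁ ()
    ...   | inj₂ (b≡1 , _) = there (here b≡1)
    cover-0 e | inj₁ (inj₂ (inj₁ (_ , b≡last))) = here b≡last
    cover-0 e | inj₁ (inj₂ (inj₂ (0≡last , _))) = contradiction 0≡last 0≢last
    cover-0 e | inj₂ (_ , b≡w) = there (there (here b≡w))

    cover-last : Cover (RT sj) last (pred last ∷ 0 ∷ w ∷ [])
    cover-last e with low-neighbours (ℕ.n<1+n last) e
    ... | inj₁ (inj₁ p) with path-neighbours p
    ...   | inj₁ b+1≡last = here (cong pred b+1≡last)
    ...   | inj₂ (refl , N<N) = contradiction N<N (ℕ.n≮n N)
    cover-last e | inj₁ (inj₂ (inj₁ (last≡0 , _))) = contradiction (sym last≡0) 0≢last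
    cover-last e | inj₁ (inj₂ (inj₂ (_ , b≡0))) = there (here b≡0)
    cover-last e | inj₂ (_ , b≡w) = there (there (here b≡w))

    cover-inner : ∀ {a} → a < N → a ≢ 0 → a ≢ last → Cover (RT sj) a (pred a ∷ suc a ∷ w ∷ [])
    cover-inner a<N a≢0 a≢last e with low-neighbours a<N e
    ... | inj₁ (inj₁ p) with path-neighbours p
    ...   | inj₁ b+1≡a = here (cong pred b+1≡a)
    ...   | inj₂ (b≡a+1 , _) = there (here b≡a+1)
    cover-inner a<N a≢0 a≢last e | inj₁ (inj₂ (inj₁ (a≡0 , _))) = contradiction a≡0 a≢0
    cover-inner a<N a≢0 a≢last e | inj₁ (inj₂ (inj₂ (a≡last , _))) = contradiction a≡last a≢last
    cover-inner a<N a≢0 a≢last e | inj₂ (_ , b≡w) = there (there (here b≡w))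

    T-degree<4 : ∀ x {m} → 3 < m → ¬ DegreeAtLeast (T sj) x m
    T-degree<4 x 3<m with region (toℕ x)
    ... | at-w x≡w = degree-single (ℕ.<-trans (s≤s (s≤s z≤n)) 3<m) (inj₁ x≡w)
    ... | at-c x≡c = degree-centre 3<m x≡c
    ... | above N<x x≢c = degree-single (ℕ.<-trans (s≤s (s≤s z≤n)) 3<m) (inj₂ (N<x , x≢c))
    ... | on-path x<N with toℕ x ℕ.≟ 0 | toℕ x ℕ.≟ last
    ...   | yes x≡0 | _ = degree-below-cover (RT sj) _ 3<m
                            (subst (λ a → Cover (RT sj) a (last ∷ 1 ∷ w ∷ [])) (sym x≡0) cover-0)
    ...   | no _ | yes x≡last =
      degree-below-cover (RT sj) _ 3<m
        (subst (λ a → Cover (RT sj) a (pred last ∷ 0 ∷ w ∷ [])) (sym x≡last) cover-last)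
    ...   | no x≢0 | no x≢last = degree-below-cover (RT sj) _ 3<m (cover-inner x<N x≢0 x≢last)

  open M-degrees using (M-degree<5; M-branch; M-centre)
  open T-degrees using (T-degree<4)

  U≇M : ∀ {j} (sj : Spot j) → ¬ Iso U (M sj)
  U≇M sj I = M-degree<5 sj _ (degree-iso {G = U} {H = M sj} I U-centre)

  U≇V : ¬ Iso U V
  U≇V I = T-degree<4 spot2 _ (ℕ.m≤n⇒m≤1+n ℕ.≤-refl) (degree-iso {G = U} {H = V} I U-centre)

  M≇V : ∀ {j} (sj : Spot j) → ¬ Iso (M sj) V
  M≇V sj I = T-degree<4 spot2 _ ℕ.≤-refl (degree-iso {G = M sj} {H = V} I (M-centre sj))

  -- U and V are not one edge move apart: after any move the centre of U keeps four neighbours.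
  U↛V : ¬ EdgeMoveDist1 U V
  U↛V (_ , G′ , mv , I) =
    T-degree<4 spot2 _ ℕ.≤-refl
      (degree-iso {G = G′} {H = V} I (degree-after-move {G = U} {G′ = G′} mv U-centre))

  suc-pred : ∀ {a} → a ≢ 0 → suc (pred a) ≡ a
  suc-pred {zero} a≢0 = contradiction refl a≢0
  suc-pred {suc a} _ = refl

  three : ℕ → ℕ → ℕ → Fin 3 → ℕ
  three a _ _ zero = a
  three _ b _ (suc zero) = b
  three _ _ d (suc (suc zero)) = d

  three-injective : ∀ {a b d} → a ≢ b → a ≢ d → b ≢ d →
                    ∀ i i′ → three a b d i ≡ three a b d i′ → i ≡ i′
  three-injective a≢b a≢d b≢d zero zero _ = refl
  three-injective a≢b a≢d b≢d zero (suc zero) eq = contradiction eq a≢b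
  three-injective a≢b a≢d b≢d zero (suc (suc zero)) eq = contradiction eq a≢d
  three-injective a≢b a≢d b≢d (suc zero) zero eq = contradiction (sym eq) a≢b
  three-injective a≢b a≢d b≢d (suc zero) (suc zero) _ = refl
  three-injective a≢b a≢d b≢d (suc zero) (suc (suc zero)) eq = contradiction eq b≢d
  three-injective a≢b a≢d b≢d (suc (suc zero)) zero eq = contradiction (sym eq) a≢d
  three-injective a≢b a≢d b≢d (suc (suc zero)) (suc zero) eq = contradiction (sym eq) b≢d
  three-injective a≢b a≢d b≢d (suc (suc zero)) (suc (suc zero)) _ = refl

  module Limbs {j} (sj : Spot j) where
    open Spot sj
    open Shape sj (path N) (λ {a} {b} → path-below {N} {a} {b}) 4

    path-step : ∀ {a b} → a < N → a ≢ j → E (RM sj) a b → suc b ≡ a ⊎ (b ≡ suc a × b < N)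
    path-step a<N a≢j e with low-neighbours a<N e
    ... | inj₁ p = path-neighbours p
    ... | inj₂ (a≡j , _) = contradiction a≡j a≢j

    low-closed : ∀ {a b} → a ≤ N → E (RM sj) a b → b ≤ N
    low-closed a≤N e with ℕ.m≤n⇒m<n∨m≡n a≤N
    low-closed a≤N e | inj₂ refl = subst (_≤ N) (sym (w-neighbours e)) (ℕ.<⇒≤ j<N)
    low-closed a≤N e | inj₁ a<N with low-neighbours a<N e
    ... | inj₁ p = ℕ.<⇒≤ (proj₂ (path-below {N} p))
    ... | inj₂ (_ , refl) = ℕ.≤-refl

    high-closed : ∀ {a b} → N < a → E (RM sj) a b → N < b
    high-closed {a} N<a e with a ℕ.≟ c
    ... | yes refl = subst (N <_) (sym (proj₂ (proj₂ (c-neighbours e)))) (N<leaf _)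
    ... | no a≢c = subst (N <_) (sym (high-neighbours N<a a≢c e)) N<c

    leaf-cases : ∀ {x} → Leaf (M sj) x →
                 toℕ x ≡ 0 ⊎ toℕ x ≡ last ⊎ toℕ x ≡ w ⊎ (N < toℕ x × toℕ x ≢ c)
    leaf-cases {x} (y , _ , only-y) with region (toℕ x)
    ... | at-w x≡w = inj₂ (inj₂ (inj₁ x≡w))
    ... | above N<x x≢c = inj₂ (inj₂ (inj₂ (N<x , x≢c)))
    ... | at-c x≡c = contradiction
                       (leaf-injective (vertex-injective (leaf-vertex z≤n) (leaf-vertex (s≤s z≤n))
                         (trans (only-y _ (centre-edge 0 (s≤s z≤n)))
                                (sym (only-y _ (centre-edge 1 (s≤s (s≤s z≤n))))))))
                       (λ ())
      where
      centre-edge : ∀ i → i < 4 → Adj (M sj) x (vertex (leaf i))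
      centre-edge i i<4 = Adj-vertex (RM sj) (leaf-vertex (ℕ.<⇒≤ i<4))
                              (subst (λ a → E (RM sj) a (leaf i)) (sym x≡c) (inj₁ (inj₂ (star-edge i<4))))
    ... | on-path x<N with toℕ x ℕ.≟ 0 | toℕ x ℕ.≟ last
    ...   | yes x≡0 | _ = inj₁ x≡0
    ...   | no _ | yes x≡last = inj₂ (inj₁ x≡last)
    ...   | no x≢0 | no x≢last = contradiction (vertex-injective (<N⇒vertex (ℕ.≤-<-trans ℕ.pred[n]≤n x<N))
                                                                (<N⇒vertex x+1<N)
                                                 (trans (only-y _ before) (sym (only-y _ after))))
                                              (ℕ.<⇒≢ (s≤s ℕ.pred[n]≤n))
      where
      x+1<N : suc (toℕ x) < N
      x+1<N = ℕ.≤∧≢⇒< x<N (x≢last ∘ ℕ.suc-injective)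
      before : Adj (M sj) x (vertex (pred (toℕ x)))
      before = Adj-vertex (RM sj) (<N⇒vertex (ℕ.≤-<-trans ℕ.pred[n]≤n x<N))
                 (inj₁ (inj₁ (inj₂ (suc-pred x≢0 , x<N))))
      after : Adj (M sj) x (vertex (suc (toℕ x)))
      after = Adj-vertex (RM sj) (<N⇒vertex x+1<N) (inj₁ (inj₁ (inj₁ (refl , x+1<N))))

    limb-j : Limb (M sj) j
    limb-j = record
      { walk     = vertex
      ; distinct = λ s≤j s′≤j → vertex-injective (up-to-j s≤j) (up-to-j s′≤j)
      ; steps    = λ s<j → Adj-vertices (RM sj) (up-to-j (ℕ.<⇒≤ s<j)) (up-to-j s<j)
                             (inj₁ (inj₁ (inj₁ (refl , ℕ.≤-<-trans s<j j<N))))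
      ; from-leaf = vertex 1 , edge-0-1 , only-1
      ; to-branch = degree-at-least (RM sj) (<N⇒vertex j<N) (three (pred j) (suc j) w)
                     (three-injective (ℕ.<⇒≢ (s≤s ℕ.pred[n]≤n)) (<N⇒≢ j-1<N ℕ.≤-refl) (<N⇒≢ j+1<N ℕ.≤-refl))
                     (λ { zero → <N⇒vertex j-1<N ; (suc zero) → <N⇒vertex j+1<N
                        ; (suc (suc zero)) → ≤N⇒vertex ℕ.≤-refl })
                     (λ { zero → inj₁ (inj₁ (inj₂ (suc-pred j≢0 , j<N)))
                        ; (suc zero) → inj₁ (inj₁ (inj₁ (refl , j+1<N)))
                        ; (suc (suc zero)) → inj₂ (inj₁ (refl , refl)) })
      }
      where
      up-to-j : ∀ {s} → s ≤ j → s < suc K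
      up-to-j s≤j = <N⇒vertex (ℕ.≤-<-trans s≤j j<N)
      j-1<N : pred j < N
      j-1<N = ℕ.≤-<-trans ℕ.pred[n]≤n j<N
      1≤j : 1 ≤ j
      1≤j = ℕ.<-≤-trans (s≤s z≤n) 2≤j
      j≢0 : j ≢ 0
      j≢0 j≡0 = ℕ.<⇒≢ 1≤j (sym j≡0)
      edge-0-1 : Adj (M sj) (vertex 0) (vertex 1)
      edge-0-1 = Adj-vertices (RM sj) (up-to-j z≤n) (up-to-j 1≤j)
                   (inj₁ (inj₁ (inj₁ (refl , ℕ.≤-<-trans 1≤j j<N))))
      only-1 : ∀ z → Adj (M sj) (vertex 0) z → z ≡ vertex 1
      only-1 z e with path-step (s≤s z≤n) (j≢0 ∘ sym) (Adj-from-vertex (RM sj) (up-to-j z≤n) e)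
      ... | inj₂ (z≡1 , _) = named z z≡1

    module Analysis {t} (limb : Limb (M sj) t) where
      open Limb limb

      q : ℕ → ℕ
      q s = toℕ (walk s)

      q-distinct : ∀ {s s′} → s ≤ t → s′ ≤ t → q s ≡ q s′ → s ≡ s′
      q-distinct s≤t s′≤t = distinct s≤t s′≤t ∘ Fin.toℕ-injective

      q-step : ∀ {s} → s < t → E (RM sj) (q s) (q (suc s))
      q-step = Equivalence.to (Adj-graphOf (RM sj)) ∘ steps

      q-end : q t ≡ j ⊎ q t ≡ c
      q-end = M-branch sj (walk t) to-branch

      no-U-turn : ∀ {s} → suc (suc s) ≤ t → q (suc (suc s)) ≢ q s
      no-U-turn {s} s+2≤t eq = ℕ.<⇒≢ s<s+2 (sym (q-distinct s+2≤t (ℕ.<⇒≤ (ℕ.<-≤-trans s<s+2 s+2≤t)) eq))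
        where
        s<s+2 : s < suc (suc s)
        s<s+2 = ℕ.≤-trans (ℕ.n<1+n s) (ℕ.n≤1+n _)

      stays-low : q 0 ≤ N → ∀ s → s ≤ t → q s ≤ N
      stays-low q0≤N zero _ = q0≤N
      stays-low q0≤N (suc s) s<t = low-closed (stays-low q0≤N s (ℕ.<⇒≤ s<t)) (q-step s<t)

      stays-high : N < q 0 → ∀ s → s ≤ t → N < q s
      stays-high N<q0 zero _ = N<q0
      stays-high N<q0 (suc s) s<t = high-closed (stays-high N<q0 s (ℕ.<⇒≤ s<t)) (q-step s<t)

      ends-at-j : q 0 ≤ N → q t ≡ j
      ends-at-j q0≤N with q-end
      ... | inj₁ qt≡j = qt≡j
      ... | inj₂ qt≡c = contradiction (subst (_≤ N) qt≡c (stays-low q0≤N t ℕ.≤-refl)) (ℕ.<⇒≱ N<c)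

      up-from-0 : q 0 ≡ 0 → ∀ s → s ≤ t → s ≤ j → q s ≡ s
      up-from-0 q0≡0 zero _ _ = q0≡0
      up-from-0 q0≡0 (suc zero) 1≤t 1≤j with path-step (subst (_< N) (sym q0≡0) (s≤s z≤n))
                                          (λ q0≡j → ℕ.<⇒≢ 1≤j (trans (sym q0≡0) q0≡j)) (q-step 1≤t)
      ... | inj₂ (q1≡ , _) = trans q1≡ (cong suc q0≡0)
      ... | inj₁ back = contradiction (trans back q0≡0) λ ()
      up-from-0 q0≡0 (suc (suc s)) s+2≤t s+2≤j
        with up-from-0 q0≡0 (suc s) (ℕ.<⇒≤ s+2≤t) (ℕ.<⇒≤ s+2≤j)
      ... | q[s+1]≡ with path-step (subst (_< N) (sym q[s+1]≡) (ℕ.<-trans s+2≤j j<N))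
                                   (λ e → ℕ.<⇒≢ s+2≤j (trans (sym q[s+1]≡) e)) (q-step s+2≤t)
      ...   | inj₂ (q[s+2]≡ , _) = trans q[s+2]≡ (cong suc q[s+1]≡)
      ...   | inj₁ back = contradiction (trans (ℕ.suc-injective (trans back q[s+1]≡))
                          (sym (up-from-0 q0≡0 s (ℕ.≤-trans (ℕ.n≤1+n s) (ℕ.<⇒≤ s+2≤t))
                                                 (ℕ.≤-trans (ℕ.n≤1+n s) (ℕ.<⇒≤ s+2≤j)))))
                          (no-U-turn s+2≤t)

      from-0 : q 0 ≡ 0 → t ≡ j
      from-0 q0≡0 with ℕ.≤-total t j | ends-at-j (subst (_≤ N) (sym q0≡0) z≤n)
      ... | inj₁ t≤j | qt≡j = trans (sym (up-from-0 q0≡0 t ℕ.≤-refl t≤j)) qt≡j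
      ... | inj₂ j≤t | qt≡j = q-distinct ℕ.≤-refl j≤t (trans qt≡j (sym (up-from-0 q0≡0 j j≤t ℕ.≤-refl)))

      beyond-j : ∀ {a s} → j + suc s ≤ last → a + s ≡ last → j < a
      beyond-j {a} {s} j+s+1≤last a+s≡last =
        ℕ.+-cancelʳ-≤ s (suc j) a (subst₂ _≤_ (ℕ.+-suc j s) (sym a+s≡last) j+s+1≤last)

      down-from-last : q 0 ≡ last → ∀ s → s ≤ t → j + s ≤ last → q s + s ≡ last
      down-from-last q0≡last zero _ _ = trans (ℕ.+-identityʳ _) q0≡last
      down-from-last q0≡last (suc zero) 1≤t j+1≤last
        with path-step (subst (_< N) (sym q0≡last) ℕ.≤-refl)
                       (ℕ.<⇒≢ (beyond-j j+1≤last (trans (ℕ.+-identityʳ _) q0≡last)) ∘ sym) (q-step 1≤t)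
      ... | inj₁ back = trans (ℕ.+-comm (q 1) 1) (trans back q0≡last)
      ... | inj₂ (q1≡ , q1<N) = contradiction (subst (_< N) (trans q1≡ (cong suc q0≡last)) q1<N) (ℕ.n≮n N)
      down-from-last q0≡last (suc (suc s)) s+2≤t j+s+2≤last
        with down-from-last q0≡last (suc s) (ℕ.<⇒≤ s+2≤t) (ℕ.≤-trans (ℕ.+-monoʳ-≤ j (ℕ.n≤1+n _)) j+s+2≤last)
      ... | q[s+1]+s+1≡last
        with path-step (ℕ.≤-<-trans (ℕ.≤-trans (ℕ.m≤m+n _ _) (ℕ.≤-reflexive q[s+1]+s+1≡last)) (ℕ.n<1+n last))
                       (ℕ.<⇒≢ (beyond-j j+s+2≤last q[s+1]+s+1≡last) ∘ sym) (q-step s+2≤t)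
      ...   | inj₁ back =
        trans (ℕ.+-suc (q (suc (suc s))) (suc s)) (trans (cong (_+ suc s) back) q[s+1]+s+1≡last)
      ...   | inj₂ (q[s+2]≡ , _) = contradiction (trans q[s+2]≡ (sym q[s]≡)) (no-U-turn s+2≤t)
        where
        q[s]+s≡last : q s + s ≡ last
        q[s]+s≡last = down-from-last q0≡last s (ℕ.≤-trans (ℕ.n≤1+n s) (ℕ.<⇒≤ s+2≤t))
                        (ℕ.≤-trans (ℕ.+-monoʳ-≤ j (ℕ.≤-trans (ℕ.n≤1+n s) (ℕ.n≤1+n _))) j+s+2≤last)
        q[s]≡ : q s ≡ suc (q (suc s))
        q[s]≡ = ℕ.+-cancelʳ-≡ s _ _ (trans q[s]+s≡last (trans (sym q[s+1]+s+1≡last) (ℕ.+-suc (q (suc s)) s)))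

      from-last : q 0 ≡ last → j + t ≡ last
      from-last q0≡last with j + t ℕ.≤? last | ends-at-j (subst (_≤ N) (sym q0≡last) (ℕ.n≤1+n last))
      ... | yes j+t≤last | qt≡j =
        trans (cong (_+ t) (sym qt≡j)) (down-from-last q0≡last t ℕ.≤-refl j+t≤last)
      ... | no j+t≰last | qt≡j = contradiction (q-distinct ℕ.≤-refl (ℕ.<⇒≤ s₀<t) (trans qt≡j (sym q[s₀]≡j)))
                                               (ℕ.<⇒≢ s₀<t ∘ sym)
        where
        s₀ : ℕ
        s₀ = last ∸ j
        j+s₀≡last : j + s₀ ≡ last
        j+s₀≡last = ℕ.m+[n∸m]≡n (ℕ.≤-pred j<N)
        s₀<t : s₀ < t
        s₀<t = ℕ.+-cancelˡ-< j s₀ t (subst (_< j + t) (sym j+s₀≡last) (ℕ.≰⇒> j+t≰last))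
        q[s₀]≡j : q s₀ ≡ j
        q[s₀]≡j = ℕ.+-cancelʳ-≡ s₀ _ _
          (trans (down-from-last q0≡last s₀ (ℕ.<⇒≤ s₀<t) (ℕ.≤-reflexive j+s₀≡last)) (sym j+s₀≡last))

      nonempty : q 0 ≢ j → q 0 ≢ c → 0 < t
      nonempty q0≢j q0≢c = ℕ.n≢0⇒n>0 λ t≡0 → case-end t≡0 q-end
        where
        case-end : t ≡ 0 → q t ≡ j ⊎ q t ≡ c → ⊥
        case-end t≡0 (inj₁ qt≡j) = q0≢j (subst (λ s → q s ≡ j) t≡0 qt≡j)
        case-end t≡0 (inj₂ qt≡c) = q0≢c (subst (λ s → q s ≡ c) t≡0 qt≡c)

      from-w : q 0 ≡ w → t ≡ 1
      from-w q0≡w = q-distinct ℕ.≤-refl 0<t (trans qt≡j (sym q1≡j))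
        where
        qt≡j : q t ≡ j
        qt≡j = ends-at-j (ℕ.≤-reflexive q0≡w)
        0<t : 0 < t
        0<t = nonempty (λ q0≡j → <N⇒≢ j<N ℕ.≤-refl (trans (sym q0≡j) q0≡w))
                       (λ q0≡c → ℕ.<⇒≢ N<c (trans (sym q0≡w) q0≡c))
        q1≡j : q 1 ≡ j
        q1≡j = w-neighbours (subst (λ a → E (RM sj) a (q 1)) q0≡w (q-step 0<t))

      from-above : N < q 0 → q 0 ≢ c → t ≡ 1
      from-above N<q0 q0≢c = q-distinct ℕ.≤-refl 0<t (trans qt≡c (sym q1≡c))
        where
        qt≡c : q t ≡ c
        qt≡c with q-end
        ... | inj₂ qt≡c = qt≡c
        ... | inj₁ qt≡j = contradiction (subst (N <_) qt≡j (stays-high N<q0 t ℕ.≤-refl)) (ℕ.<⇒≯ j<N)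
        0<t : 0 < t
        0<t = nonempty (λ q0≡j → ℕ.<⇒≯ j<N (subst (N <_) q0≡j N<q0)) q0≢c
        q1≡c : q 1 ≡ c
        q1≡c = high-neighbours N<q0 q0≢c (q-step 0<t)

      length : t ≡ 1 ⊎ t ≡ j ⊎ j + t ≡ last
      length with leaf-cases from-leaf
      ... | inj₁ q0≡0 = inj₂ (inj₁ (from-0 q0≡0))
      ... | inj₂ (inj₁ q0≡last) = inj₂ (inj₂ (from-last q0≡last))
      ... | inj₂ (inj₂ (inj₁ q0≡w)) = inj₁ (from-w q0≡w)
      ... | inj₂ (inj₂ (inj₂ (N<q0 , q0≢c))) = inj₁ (from-above N<q0 q0≢c)

  -- Distinct attachment points give non-isomorphic graphs M j: M j has a limb
  -- of length j, while the limbs of M j′ have lengths 1, j′ and last - j′.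
  M≇M : ∀ {j j′} (sj : Spot j) (sj′ : Spot j′) → j ≢ j′ → ¬ Iso (M sj) (M sj′)
  M≇M {j} {j′} sj sj′ j≢j′ I
    with Limbs.Analysis.length sj′ (limb-iso {G = M sj} {H = M sj′} I (Limbs.limb-j sj))
  ... | inj₁ j≡1 = ℕ.<⇒≢ (Spot.2≤j sj) (sym j≡1)
  ... | inj₂ (inj₁ j≡j′) = j≢j′ j≡j′
  ... | inj₂ (inj₂ j′+j≡last) = ℕ.<⇒≢ j′+j<last j′+j≡last
    where
    j′+j<last : j′ + j < last
    j′+j<last = ℕ.+-mono-≤-< (ℕ.≤-pred (Spot.j<n sj′)) (Spot.j<n sj)

  -- T j ≅ V: reflecting the cycle moves the pendant from j to 2.
  -- An involution preserving a relation maps it onto itself.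
  involution-⇔ : ∀ {ρ : ℕ → ℕ} (R : SymRel) → (∀ a → ρ (ρ a) ≡ a) →
                 (∀ {a b} → E R a b → E R (ρ a) (ρ b)) → ∀ a b → E R (ρ a) (ρ b) ⇔ E R a b
  involution-⇔ {ρ} R ρρ preserves a b =
    mk⇔ (subst₂ (E R) (ρρ a) (ρρ b) ∘ preserves) preserves

  module Reflection {j} (sj : Spot j) where
    open Spot sj

    -- ρ reflects the cycle 0, 1, …, last, 0 so that j ↔ 2 (and 0 ↔ s = j + 2),
    -- fixing every vertex from N on.
    s : ℕ
    s = j + 2

    s+1<N : suc s < N
    s+1<N = subst (_< N) (ℕ.+-suc j 2) (ℕ.+-mono-< j<n (ℕ.<-≤-trans (s≤s (s≤s (s≤s (s≤s z≤n)))) 5≤n))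

    ρ : ℕ → ℕ
    ρ a with a ℕ.<? N | a ℕ.≤? s
    ... | no _ | _ = a
    ... | yes _ | yes _ = s ∸ a
    ... | yes _ | no _ = (N + s) ∸ a

    ρ-fixed : ∀ {a} → N ≤ a → ρ a ≡ a
    ρ-fixed {a} N≤a with a ℕ.<? N
    ... | yes a<N = contradiction N≤a (ℕ.<⇒≱ a<N)
    ... | no _ = refl

    ρ-low : ∀ {a} → a ≤ s → ρ a + a ≡ s
    ρ-low {a} a≤s with a ℕ.<? N | a ℕ.≤? s
    ... | no a≮N | _ = contradiction (ℕ.≤-<-trans a≤s (ℕ.<-trans (ℕ.n<1+n s) s+1<N)) a≮N
    ... | yes _ | yes _ = ℕ.m∸n+n≡m a≤s
    ... | yes _ | no a≰s = contradiction a≤s a≰s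

    ρ-high : ∀ {a} → s < a → a < N → ρ a + a ≡ N + s
    ρ-high {a} s<a a<N with a ℕ.<? N | a ℕ.≤? s
    ... | no a≮N | _ = contradiction a<N a≮N
    ... | yes _ | yes a≤s = contradiction a≤s (ℕ.<⇒≱ s<a)
    ... | yes _ | no _ = ℕ.m∸n+n≡m (ℕ.≤-trans (ℕ.<⇒≤ a<N) (ℕ.m≤m+n N s))

    s<N : s < N
    s<N = ℕ.<-trans (ℕ.n<1+n s) s+1<N

    ρ-low-range : ∀ {a} → a ≤ s → ρ a ≤ s
    ρ-low-range {a} a≤s = ℕ.≤-trans (ℕ.m≤m+n (ρ a) a) (ℕ.≤-reflexive (ρ-low a≤s))

    ρ-high-range : ∀ {a} → s < a → a < N → s < ρ a × ρ a < N
    ρ-high-range {a} s<a a<N =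
      ℕ.+-cancelʳ-< a s (ρ a)
        (subst (s + a <_) (trans (ℕ.+-comm s N) (sym (ρ-high s<a a<N))) (ℕ.+-monoʳ-< s a<N)) ,
      ℕ.+-cancelʳ-< a (ρ a) N (subst (_< N + a) (sym (ρ-high s<a a<N)) (ℕ.+-monoʳ-< N s<a))

    low-or-high : ∀ a → a ≤ s ⊎ (s < a × a < N) ⊎ N ≤ a
    low-or-high a with a ℕ.<? N
    ... | no a≮N = inj₂ (inj₂ (ℕ.≮⇒≥ a≮N))
    ... | yes a<N with a ℕ.≤? s
    ...   | yes a≤s = inj₁ a≤s
    ...   | no a≰s = inj₂ (inj₁ (ℕ.≰⇒> a≰s , a<N))

    ρ<N : ∀ {a} → a < N → ρ a < N
    ρ<N {a} a<N with low-or-high a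
    ... | inj₁ a≤s = ℕ.≤-<-trans (ρ-low-range a≤s) s<N
    ... | inj₂ (inj₁ (s<a , _)) = proj₂ (ρ-high-range s<a a<N)
    ... | inj₂ (inj₂ N≤a) = contradiction N≤a (ℕ.<⇒≱ a<N)

    ρρ : ∀ a → ρ (ρ a) ≡ a
    ρρ a with low-or-high a
    ... | inj₂ (inj₂ N≤a) = trans (cong ρ (ρ-fixed N≤a)) (ρ-fixed N≤a)
    ... | inj₁ a≤s = ℕ.+-cancelʳ-≡ (ρ a) _ _
                       (trans (ρ-low (ρ-low-range a≤s)) (trans (sym (ρ-low a≤s)) (ℕ.+-comm (ρ a) a)))
    ... | inj₂ (inj₁ (s<a , a<N)) = ℕ.+-cancelʳ-≡ (ρ a) _ _
                       (trans (ρ-high s<ρa ρa<N) (trans (sym (ρ-high s<a a<N)) (ℕ.+-comm (ρ a) a)))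
      where
      s<ρa = proj₁ (ρ-high-range s<a a<N)
      ρa<N = proj₂ (ρ-high-range s<a a<N)

    ρ-vertex : ∀ {a} → a < suc K → ρ a < suc K
    ρ-vertex {a} a<K with low-or-high a
    ... | inj₂ (inj₂ N≤a) = subst (_< suc K) (sym (ρ-fixed N≤a)) a<K
    ... | inj₁ a≤s = <N⇒vertex (ρ<N (ℕ.≤-<-trans a≤s s<N))
    ... | inj₂ (inj₁ (_ , a<N)) = <N⇒vertex (ρ<N a<N)

    ρ-j : ρ j ≡ 2
    ρ-j = ℕ.+-cancelʳ-≡ j _ _ (trans (ρ-low (ℕ.m≤m+n j 2)) (ℕ.+-comm j 2))

    ρ-2 : ρ 2 ≡ j
    ρ-2 = trans (cong ρ (sym ρ-j)) (ρρ j)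

    ρ-0 : ρ 0 ≡ s
    ρ-0 = trans (sym (ℕ.+-identityʳ (ρ 0))) (ρ-low z≤n)

    ρ-last : ρ last ≡ suc s
    ρ-last = ℕ.+-cancelʳ-≡ last _ _
      (trans (ρ-high (ℕ.≤-pred s+1<N) (ℕ.n<1+n last)) (cong suc (ℕ.+-comm last s)))

    ρ-s : ρ s ≡ 0
    ρ-s = ℕ.+-cancelʳ-≡ s _ _ (ρ-low ℕ.≤-refl)

    ρ-s+1 : ρ (suc s) ≡ last
    ρ-s+1 = ℕ.+-cancelʳ-≡ s _ _ (ℕ.suc-injective
      (trans (sym (ℕ.+-suc (ρ (suc s)) s)) (ρ-high (ℕ.n<1+n s) s+1<N)))

    -- ρ reverses a path step a → a + 1 on which ρ a + a = ρ (a + 1) + (a + 1) …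
    reversed : ∀ {a t} → a < N → ρ (suc a) + suc a ≡ t → ρ a + a ≡ t → E cycle (ρ a) (ρ (suc a))
    reversed {a} a<N e₁ e₀ =
      inj₁ (inj₂ (ℕ.+-cancelʳ-≡ a _ _ (trans (sym (ℕ.+-suc (ρ (suc a)) a)) (trans e₁ (sym e₀))) , ρ<N a<N))

    -- … which covers every step except s → s + 1, sent to the closing edge {0, last};
    -- so ρ maps cycle edges to cycle edges
    ρ-step : ∀ {a b} → Step N a b → E cycle (ρ a) (ρ b)
    ρ-step {a} (refl , a+1<N) with ℕ.<-cmp a s
    ... | tri≈ _ refl _ = inj₂ (inj₁ (ρ-s , ρ-s+1))
    ... | tri< a<s _ _ = reversed a<N (ρ-low a<s) (ρ-low (ℕ.<⇒≤ a<s))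
      where a<N = ℕ.<-trans (ℕ.n<1+n a) a+1<N
    ... | tri> _ _ s<a = reversed a<N (ρ-high (ℕ.<-trans s<a (ℕ.n<1+n a)) a+1<N) (ρ-high s<a a<N)
      where a<N = ℕ.<-trans (ℕ.n<1+n a) a+1<N

    ρ-cycle : ∀ {a b} → E cycle a b → E cycle (ρ a) (ρ b)
    ρ-cycle (inj₁ (inj₁ step)) = ρ-step step
    ρ-cycle (inj₁ (inj₂ step)) = E-sym cycle (ρ-step step)
    ρ-cycle (inj₂ (inj₁ (refl , refl))) = subst₂ (E cycle) (sym ρ-0) (sym ρ-last) (inj₁ (inj₁ (refl , s+1<N)))
    ρ-cycle (inj₂ (inj₂ (refl , refl))) = subst₂ (E cycle) (sym ρ-last) (sym ρ-0) (inj₁ (inj₂ (refl , s+1<N)))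

    ρ-star : ∀ {r a b} → E (star r) a b → E (star r) (ρ a) (ρ b)
    ρ-star {r} {a} {b} e with star-above {r} {a} {b} e
    ... | N<a , N<b = subst₂ (E (star r)) (sym (ρ-fixed (ℕ.<⇒≤ N<a))) (sym (ρ-fixed (ℕ.<⇒≤ N<b))) e

    ρ-pendant : ∀ a b → E (pendant spot2) (ρ a) (ρ b) ⇔ E (pendant sj) a b
    ρ-pendant a b = mk⇔
      (λ { (inj₁ (ρa≡2 , ρb≡w)) → inj₁ (from-2 ρa≡2 , from-w ρb≡w)
         ; (inj₂ (ρa≡w , ρb≡2)) → inj₂ (from-w ρa≡w , from-2 ρb≡2) })
      (λ { (inj₁ (refl , refl)) → inj₁ (ρ-j , ρ-fixed ℕ.≤-refl)
         ; (inj₂ (refl , refl)) → inj₂ (ρ-fixed ℕ.≤-refl , ρ-j) })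
      where
      from-2 : ∀ {a} → ρ a ≡ 2 → a ≡ j
      from-2 {a} ρa≡2 = trans (sym (ρρ a)) (trans (cong ρ ρa≡2) ρ-2)
      from-w : ∀ {a} → ρ a ≡ w → a ≡ w
      from-w {a} ρa≡w = trans (sym (ρρ a)) (trans (cong ρ ρa≡w) (ρ-fixed ℕ.≤-refl))

    T≅V : Iso (T sj) V
    T≅V = relabel-iso (RT spot2) (RT sj) ρ ρρ ρ-vertex λ a b →
      (involution-⇔ cycle ρρ ρ-cycle a b ⊎-⇔ involution-⇔ (star 3) ρρ (ρ-star {3}) a b) ⊎-⇔ ρ-pendant a b

  spot-of : ∀ m → 2 + m < n → Spot (2 + m)
  spot-of m = spot (s≤s (s≤s z≤n))

  member : (a : ℕ) → a < n → Graph (suc K)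
  member zero _ = U
  member (suc zero) _ = V
  member (suc (suc m)) a<n = M (spot-of m a<n)

  M→U : ∀ {j} (sj : Spot j) → EdgeMoveDist1 (M sj) U
  M→U sj = U≇M sj ∘ Iso-sym {G = M sj} {H = U} , U , move-MU sj , Iso-refl U

  M→V : ∀ {j} (sj : Spot j) → EdgeMoveDist1 (M sj) V
  M→V sj = M≇V sj , T sj , move-MT sj , Reflection.T≅V sj

  M→M : ∀ {j j′} (sj : Spot j) (sj′ : Spot j′) → j ≢ j′ → EdgeMoveDist1 (M sj) (M sj′)
  M→M sj sj′ j≢j′ = M≇M sj sj′ j≢j′ , M sj′ , move-MM sj sj′ j≢j′ , Iso-refl (M sj′)

  -- every member has as many edges as M 2, being one edge move away from it
  member-size : ∀ a (a<n : a < n) → size (member a a<n) ≡ size (M spot2)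
  member-size zero _ = sym (size-move {G = M spot2} {G′ = U} (move-MU spot2))
  member-size (suc zero) _ = sym (size-move {G = M spot2} {G′ = V} (move-MT spot2))
  member-size (suc (suc zero)) _ = refl
  member-size (suc (suc (suc m))) a<n =
    size-move {G = member (3 + m) a<n} {G′ = M spot2} (move-MM (spot-of (suc m) a<n) spot2 (λ ()))

  member-noniso : ∀ a b (a<n : a < n) (b<n : b < n) → a ≢ b → ¬ Iso (member a a<n) (member b b<n)
  member-noniso zero zero _ _ a≢b = contradiction refl a≢b
  member-noniso (suc zero) (suc zero) _ _ a≢b = contradiction refl a≢b
  member-noniso zero (suc zero) _ _ _ = U≇V
  member-noniso (suc zero) zero _ _ _ = U≇V ∘ Iso-sym {G = V} {H = U}
  member-noniso zero (suc (suc m)) _ b<n _ = U≇M (spot-of m b<n)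
  member-noniso (suc (suc m)) zero a<n _ _ = U≇M (spot-of m a<n) ∘ Iso-sym {G = member (2 + m) a<n} {H = U}
  member-noniso (suc zero) (suc (suc m)) _ b<n _ =
    M≇V (spot-of m b<n) ∘ Iso-sym {G = V} {H = member (2 + m) b<n}
  member-noniso (suc (suc m)) (suc zero) a<n _ _ = M≇V (spot-of m a<n)
  member-noniso (suc (suc m)) (suc (suc m′)) a<n b<n a≢b = M≇M (spot-of m a<n) (spot-of m′ b<n) a≢b

  -- members other than U and V are one edge move apart …
  member-close : ∀ a b (a<n : a < n) (b<n : b < n) → a ≢ b → ¬ Pair 0 1 a b →
                 EdgeMoveDist1 (member a a<n) (member b b<n)
  member-close zero zero _ _ a≢b _ = contradiction refl a≢b
  member-close (suc zero) (suc zero) _ _ a≢b _ = contradiction refl a≢b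
  member-close zero (suc zero) _ _ _ not-UV = contradiction (inj₁ (refl , refl)) not-UV
  member-close (suc zero) zero _ _ _ not-UV = contradiction (inj₂ (refl , refl)) not-UV
  member-close zero (suc (suc m)) _ b<n _ _ =
    EdgeMoveDist1-sym {G = member (2 + m) b<n} {H = U} (M→U (spot-of m b<n))
  member-close (suc (suc m)) zero a<n _ _ _ = M→U (spot-of m a<n)
  member-close (suc zero) (suc (suc m)) _ b<n _ _ =
    EdgeMoveDist1-sym {G = member (2 + m) b<n} {H = V} (M→V (spot-of m b<n))
  member-close (suc (suc m)) (suc zero) a<n _ _ _ = M→V (spot-of m a<n)
  member-close (suc (suc m)) (suc (suc m′)) a<n b<n a≢b _ = M→M (spot-of m a<n) (spot-of m′ b<n) a≢b

  -- … and only those: equal members are isomorphic and U, V are far apart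
  member-apart : ∀ a b (a<n : a < n) (b<n : b < n) →
                 EdgeMoveDist1 (member a a<n) (member b b<n) → a ≢ b × ¬ Pair 0 1 a b
  member-apart a b a<n b<n d@(non-iso , _) = a≢b , not-UV
    where
    a≢b : a ≢ b
    a≢b refl = non-iso (subst (λ p → Iso (member a a<n) (member a p)) (ℕ.<-irrelevant a<n b<n)
                          (Iso-refl (member a a<n)))
    not-UV : ¬ Pair 0 1 a b
    not-UV (inj₁ (refl , refl)) = U↛V d
    not-UV (inj₂ (refl , refl)) = U↛V (EdgeMoveDist1-sym {G = V} {H = U} d)

≢⇔not-≡ᵇ : ∀ a b → (not (a ≡ᵇ b) ∧ true) ≡ true ⇔ a ≢ b
≢⇔not-≡ᵇ zero zero = mk⇔ (λ ()) (λ 0≢0 → contradiction refl 0≢0)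
≢⇔not-≡ᵇ zero (suc b) = mk⇔ (λ _ ()) (λ _ → refl)
≢⇔not-≡ᵇ (suc a) zero = mk⇔ (λ _ ()) (λ _ → refl)
≢⇔not-≡ᵇ (suc a) (suc b) = mk⇔ (λ t → Equivalence.to (≢⇔not-≡ᵇ a b) t ∘ ℕ.suc-injective)
                                (λ ne → Equivalence.from (≢⇔not-≡ᵇ a b) (ne ∘ cong suc))

KnMinusEdge-adj : ∀ n (i j : Fin n) →
  Adj (KnMinusEdge n) i j ⇔ (toℕ i ≢ toℕ j × ¬ Pair 0 1 (toℕ i) (toℕ j))
KnMinusEdge-adj n i j with toℕ i | toℕ j
... | zero | zero = mk⇔ (λ ()) (λ (0≢0 , _) → contradiction refl 0≢0)
... | zero | suc zero = mk⇔ (λ ()) (λ (_ , ¬01) → contradiction (inj₁ (refl , refl)) ¬01)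
... | suc zero | zero = mk⇔ (λ ()) (λ (_ , ¬01) → contradiction (inj₂ (refl , refl)) ¬01)
... | suc zero | suc zero = mk⇔ (λ ()) (λ (1≢1 , _) → contradiction refl 1≢1)
... | zero | suc (suc b) = mk⇔ (λ _ → (λ ()) , λ { (inj₁ (_ , ())) ; (inj₂ (() , _)) }) (λ _ → refl)
... | suc (suc a) | zero = mk⇔ (λ _ → (λ ()) , λ { (inj₁ (() , _)) ; (inj₂ (() , _)) }) (λ _ → refl)
... | suc zero | suc (suc b) = mk⇔ (λ _ → (λ ()) , λ { (inj₁ (() , _)) ; (inj₂ (_ , ())) }) (λ _ → refl)
... | suc (suc a) | suc zero = mk⇔ (λ _ → (λ ()) , λ { (inj₁ (() , _)) ; (inj₂ (() , _)) }) (λ _ → refl)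
... | suc (suc a) | suc (suc b) =
  mk⇔ (λ t → Equivalence.to (≢⇔not-≡ᵇ (suc (suc a)) (suc (suc b))) t ,
             λ { (inj₁ (() , _)) ; (inj₂ (() , _)) })
      (Equivalence.from (≢⇔not-≡ᵇ (suc (suc a)) (suc (suc b))) ∘ λ (ne , _) → ne)

proposition12 : (n : ℕ) → 5 ≤ n →
    IsEdgeMoveDistanceGraph (KnMinusEdge n) × ¬ IsJIS (KnMinusEdge n)
proposition12 (suc n′) (s≤s 4≤n′) =
  (suc K , S , non-isomorphic , equal-size , adjacency) , not-JIS n 5≤n
  where
  open Construction n′ 4≤n′
  S : Fin n → Graph (suc K)
  S i = member (toℕ i) (Fin.toℕ<n i)
  non-isomorphic : ∀ i j → i ≢ j → ¬ Iso (S i) (S j)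
  non-isomorphic i j i≢j = member-noniso _ _ _ _ (i≢j ∘ Fin.toℕ-injective)
  equal-size : ∀ i j → size (S i) ≡ size (S j)
  equal-size i j = trans (member-size (toℕ i) (Fin.toℕ<n i)) (sym (member-size (toℕ j) (Fin.toℕ<n j)))
  -- i ~ j in K_n minus {0,1}  ⇔  toℕ i, toℕ j distinct and not {0,1}  ⇔  S i, S j one move apart
  adjacency : ∀ i j → Adj (KnMinusEdge n) i j ⇔ EdgeMoveDist1 (S i) (S j)
  adjacency i j = mk⇔
    (λ ij → let (i≢j , not-UV) = Equivalence.to (KnMinusEdge-adj n i j) ij in member-close _ _ _ _ i≢j not-UV)
    (Equivalence.from (KnMinusEdge-adj n i j) ∘ member-apart _ _ _ _)
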